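{- Let $t \ge 2$ and let $r \ge 2$ be prime, and let $H_{r,t}$ be the $\frac{r^t-1}{r-1} \times r^t$ real matrix defined below. Then $H_{r,t}$ has orthonormal rows, and each column of $H_{r,t}$ other than the column corresponding to the point $P_j = 0$ contains exactly $\frac{r^{t-1}-1}{r-1}$ entries equal to $\frac{1-r}{\sqrt{r^t(r-1)}}$.
   Context: Let $\ell = \frac{r^t - 1}{r-1}$, let $V_1, \dots, V_\ell$ be an enumeration of the hyperplanes (i.e. $(t-1)$-dimensional linear subspaces) of $\mathbb{F}_r^t$ and $P_1, \dots, P_{r^t}$ an enumeration of the points of $\mathbb{F}_r^t$. $H_{r,t}$ is the $\ell \times r^t$ matrix with entries $(H_{r,t})_{ij} = \frac{1}{\sqrt{r^t(r-1)}}$ if $P_j \notin V_i$ and $(H_{r,t})_{ij} = \frac{1-r}{\sqrt{r^t(r-1)}}$ if $P_j \in V_i$. -}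

module Defs where

open import Level using (Level)
open import Function using (_∘_)
open import Data.Nat using (ℕ; zero; suc; _+_; _*_; _∸_; _^_; NonZero)
open import Data.Nat.DivMod using (_mod_; _/_)
open import Data.Fin using (Fin; toℕ) renaming (zero to fz; suc to fs)
open import Data.Fin.Properties using () renaming (_≟_ to _≟F_)
open import Data.Vec using (Vec; replicate; zipWith; map)
open import Data.Bool using (Bool; true; false; if_then_else_)
open import Data.Product using (Σ; ∃; _×_)
open import Relation.Nullary using (does)
open import Relation.Binary.PropositionalEquality using (_≡_)
open import Algebra.Bundles using (CommutativeRing)

module _ {r : ℕ} .{{_ : NonZero r}} where

  _+F_ : Fin r → Fin r → Fin r
  a +F b = (toℕ a + toℕ b) mod r

  _*F_ : Fin r → Fin r → Fin r
  a *F b = (toℕ a * toℕ b) mod r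

  0F : Fin r
  0F = 0 mod r

Point : ℕ → ℕ → Set
Point r t = Vec (Fin r) t

PSet : ℕ → ℕ → Set
PSet r t = Point r t → Bool

module _ {r t : ℕ} .{{_ : NonZero r}} where

  0P : Point r t
  0P = replicate t 0F

  _+P_ : Point r t → Point r t → Point r t
  _+P_ = zipWith _+F_

  _·P_ : Fin r → Point r t → Point r t
  c ·P x = map (c *F_) x

  lincomb : ∀ {m} → (Fin m → Fin r) → (Fin m → Point r t) → Point r t
  lincomb {zero}  c b = 0P
  lincomb {suc m} c b = (c fz ·P b fz) +P lincomb (c ∘ fs) (b ∘ fs)

  LinIndep : ∀ {m} → (Fin m → Point r t) → Set
  LinIndep b = ∀ c → lincomb c b ≡ 0P → ∀ i → c i ≡ 0F

  IsSpanOf : ∀ {m} → PSet r t → (Fin m → Point r t) → Set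
  IsSpanOf S b = ∀ x → (S x ≡ true → ∃ λ c → lincomb c b ≡ x)
                     × ((∃ λ c → lincomb c b ≡ x) → S x ≡ true)

  IsSubspaceOfDim : PSet r t → ℕ → Set
  IsSubspaceOfDim S d = Σ (Fin d → Point r t) λ b → LinIndep b × IsSpanOf S b

  IsHyperplane : PSet r t → Set
  IsHyperplane S = IsSubspaceOfDim S (t ∸ 1)

  SameSet : PSet r t → PSet r t → Set
  SameSet S T = ∀ x → S x ≡ T x

  IsHyperplaneEnum : ∀ {n} → (Fin n → PSet r t) → Set
  IsHyperplaneEnum {n} V =
      (∀ i → IsHyperplane (V i))
    × (∀ i k → SameSet (V i) (V k) → i ≡ k)
    × (∀ S → IsHyperplane S → ∃ λ i → SameSet S (V i))

  IsPointEnum : ∀ {n} → (Fin n → Point r t) → Set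
  IsPointEnum {n} P =
      (∀ j k → P j ≡ P k → j ≡ k)
    × (∀ x → ∃ λ j → P j ≡ x)

-- (r^n - 1)/(r - 1)  (for r ≥ 2; irrelevant junk value 0 otherwise)

gauss : ℕ → ℕ → ℕ
gauss (suc (suc k)) n = (suc (suc k) ^ n ∸ 1) / suc k
gauss _ _ = 0

-- Ring-valued notions: the matrix H_{r,t} with entries in a commutative
-- ring R, given an element sinv playing the role of 1/√(r^t (r-1)).

module RingDefs {c ℓ' : Level} (R : CommutativeRing c ℓ') where
  open CommutativeRing R using (Carrier; 0#; 1#; -_) renaming (_+_ to _+R_; _*_ to _*R_)

  fromℕR : ℕ → Carrier
  fromℕR zero    = 0#
  fromℕR (suc n) = 1# +R fromℕR n

  sumR : ∀ {n} → (Fin n → Carrier) → Carrier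
  sumR {zero}  f = 0#
  sumR {suc n} f = f fz +R sumR (f ∘ fs)

  δ : ∀ {n} → Fin n → Fin n → Carrier
  δ i k = if does (i ≟F k) then 1# else 0#

  Hmat : (r t : ℕ) {n m : ℕ} → Carrier → (Fin n → PSet r t) → (Fin m → Point r t)
       → Fin n → Fin m → Carrier
  Hmat r t sinv V P i j =
    if V i (P j) then (1# +R (- fromℕR r)) *R sinv else sinv

module Submission where

-- Over the prime field F = ℤ/r every hyperplane V i of F^t is the kernel of a
-- nonzero functional (its normal), so |V i| = r^(t-1); for i ≠ k, counting the pairs
-- (l , x) with x in the kernel of the pencil normal k + l · normal i gives
-- |V i ∩ V k| = r^(t-2).  Writing the entries as u (1 − r [P j ∈ V i]) with u = 1/s,
-- the product of rows i and k is u² (r^t − r |V i| − r |V k| + r² |V i ∩ V k|),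
-- which is u² r^t (r − 1) = 1 on the diagonal and 0 off it.
-- For the columns: the vectors l · normal i with l ≠ 0 are pairwise distinct, and
-- since there are (r^t − 1)/(r − 1) hyperplanes they exhaust the nonzero vectors.
-- Hence r − 1 times the number of hyperplanes through a point x ≠ 0 is the number
-- of nonzero a with a · x = 0, namely r^(t-1) − 1.  Characteristic zero separates
-- the two entry values u and (1 − r) u.

open import Defs
open import Level using (Level; 0ℓ)
open import Function using (_∘_; case_of_; flip)
open import Data.Nat as ℕ using (ℕ; zero; suc; _∸_; _^_; _%_; NonZero; _≤_; _<_; z≤n; s≤s)
  renaming (_+_ to _+ℕ_; _*_ to _*ℕ_)
import Data.Nat
import Data.Nat.Properties as ℕ
open import Data.Nat.Solver using (module +-*-Solver)
open import Data.Nat.DivMod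
  using (_/_; m*n/n≡m; _mod_; %-distribˡ-+; %-distribˡ-*; m%n<n; m<n⇒m%n≡m; m*n%n≡0; [m+kn]%n≡m%n)
open import Data.Nat.Divisibility using (_∣_; m%n≡0⇒n∣m; >⇒∤)
open import Data.Nat.Primality using (Prime; euclidsLemma; prime⇒nonTrivial; ¬prime[0]; ¬prime[1])
open import Data.Nat.Coprimality using (prime⇒coprime; coprime-Bézout)
open import Data.Nat.GCD using (module Bézout)
open import Data.Fin as Fin using (Fin; toℕ; combine; remQuot; _↑ˡ_; _↑ʳ_) renaming (zero to fz; suc to fs)
import Data.Fin.Properties as Fin
open import Data.Product using (∃; ∃₂; _×_; _,_; proj₁; proj₂)
open import Data.Sum using (_⊎_; inj₁; inj₂; [_,_]′)
open import Function.Bundles using (mk⇔; mk↔ₛ′)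
open import Relation.Nullary.Decidable using (dec-true; dec-false; does-⇔; T?)
open import Data.Empty using (⊥-elim)
open import Relation.Nullary using (¬_; Dec; yes; no; does)
open import Relation.Binary.PropositionalEquality
  using (_≡_; _≢_; refl; sym; trans; cong; cong₂; subst; isEquivalence; module ≡-Reasoning)
open import Algebra.Bundles using (CommutativeRing; Monoid; Ring)
open import Algebra.Structures using (IsCommutativeRing)
import Algebra.Properties.Ring as RingProperties
import Algebra.Properties.CommutativeSemigroup as CommutativeSemigroupProperties
import Algebra.Properties.Semiring.Sum as SemiringSum
import Algebra.Properties.Monoid.Sum as MonoidSum
open import Algebra.Properties.Semiring.Sum ℕ.+-*-semiring
  using (sum; sum-syntax; sum-cong-≗; ∑-distrib-+; ∑-comm; *-distribˡ-sum; *-distribʳ-sum; ∑-permute)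
open import Data.Bool using (Bool; true; false; if_then_else_; not; _∧_; T)
open import Data.Bool.Properties using (∧-zeroʳ; ∧-identityʳ; ∧-idem)
open import Data.Vec using (Vec; []; _∷_; lookup; tabulate)
import Data.Vec.Properties as Vec
import Data.Vec.Functional as Vecᶠ
open import Data.List using (List; length; filter; allFin)
import Data.List as List
open import Data.List.Relation.Unary.Unique.Propositional using (Unique)
open import Data.List.Relation.Unary.Unique.Propositional.Properties using (filter⁺; allFin⁺)
open import Data.List.Membership.Propositional using (_∈_)
open import Data.List.Membership.Propositional.Properties using (∈-filter⁺; ∈-filter⁻; ∈-allFin)
import Algebra.Solver.Ring.NaturalCoefficients.Default as CommutativeSemiringSolver
import Relation.Binary.Reasoning.Setoid as SetoidReasoning

module ResidueRing (r : ℕ) {{_ : NonZero r}} where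
  open Data.Nat using (_+_; _*_)

  ⟦_⟧ : ℕ → Fin r
  ⟦ n ⟧ = n mod r

  toℕ-⟦⟧ : ∀ n → toℕ ⟦ n ⟧ ≡ n % r
  toℕ-⟦⟧ n = Fin.toℕ-fromℕ< (m%n<n n r)

  ⟦⟧-cong-% : ∀ {m n} → m % r ≡ n % r → ⟦ m ⟧ ≡ ⟦ n ⟧
  ⟦⟧-cong-% {m} {n} eq = Fin.toℕ-injective (trans (toℕ-⟦⟧ m) (trans eq (sym (toℕ-⟦⟧ n))))

  ⟦toℕ⟧ : ∀ a → ⟦ toℕ a ⟧ ≡ a
  ⟦toℕ⟧ a = Fin.toℕ-injective (trans (toℕ-⟦⟧ (toℕ a)) (m<n⇒m%n≡m (Fin.toℕ<n a)))

  ⟦⟧-+ : ∀ m n → ⟦ m ⟧ +F ⟦ n ⟧ ≡ ⟦ m + n ⟧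
  ⟦⟧-+ m n = trans (cong₂ (λ x y → ⟦ x + y ⟧) (toℕ-⟦⟧ m) (toℕ-⟦⟧ n))
                   (⟦⟧-cong-% (sym (%-distribˡ-+ m n r)))

  ⟦⟧-* : ∀ m n → ⟦ m ⟧ *F ⟦ n ⟧ ≡ ⟦ m * n ⟧
  ⟦⟧-* m n = trans (cong₂ (λ x y → ⟦ x * y ⟧) (toℕ-⟦⟧ m) (toℕ-⟦⟧ n))
                   (⟦⟧-cong-% (sym (%-distribˡ-* m n r)))

  ⟦r*n⟧≡0F : ∀ n → ⟦ r * n ⟧ ≡ 0F
  ⟦r*n⟧≡0F n = ⟦⟧-cong-% (begin
    (r * n) % r ≡⟨ cong (_% r) (ℕ.*-comm r n) ⟩
    (n * r) % r ≡⟨ m*n%n≡0 n r ⟩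
    0           ≡⟨ m<n⇒m%n≡m (ℕ.>-nonZero⁻¹ r) ⟨
    0 % r       ∎)
    where open ≡-Reasoning

  -F_ : Fin r → Fin r
  -F a = ⟦ r ∸ 1 ⟧ *F a

  1F : Fin r
  1F = ⟦ 1 ⟧

  -- Matching on this view reduces each ring law to the corresponding law of ℕ.
  data Reduction : Fin r → Set where
    reduction : ∀ n → Reduction ⟦ n ⟧

  reduce : ∀ a → Reduction a
  reduce a = subst Reduction (⟦toℕ⟧ a) (reduction (toℕ a))

  +F-comm : ∀ a b → a +F b ≡ b +F a
  +F-comm a b with reduce a | reduce b
  ... | reduction m | reduction n =
    trans (⟦⟧-+ m n) (trans (cong ⟦_⟧ (ℕ.+-comm m n)) (sym (⟦⟧-+ n m)))

  *F-comm : ∀ a b → a *F b ≡ b *F a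
  *F-comm a b with reduce a | reduce b
  ... | reduction m | reduction n =
    trans (⟦⟧-* m n) (trans (cong ⟦_⟧ (ℕ.*-comm m n)) (sym (⟦⟧-* n m)))

  +F-assoc : ∀ a b c → (a +F b) +F c ≡ a +F (b +F c)
  +F-assoc a b c with reduce a | reduce b | reduce c
  ... | reduction m | reduction n | reduction k = begin
    (⟦ m ⟧ +F ⟦ n ⟧) +F ⟦ k ⟧ ≡⟨ cong (_+F ⟦ k ⟧) (⟦⟧-+ m n) ⟩
    ⟦ m + n ⟧ +F ⟦ k ⟧        ≡⟨ ⟦⟧-+ (m + n) k ⟩
    ⟦ m + n + k ⟧             ≡⟨ cong ⟦_⟧ (ℕ.+-assoc m n k) ⟩
    ⟦ m + (n + k) ⟧           ≡⟨ ⟦⟧-+ m (n + k) ⟨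
    ⟦ m ⟧ +F ⟦ n + k ⟧        ≡⟨ cong (⟦ m ⟧ +F_) (⟦⟧-+ n k) ⟨
    ⟦ m ⟧ +F (⟦ n ⟧ +F ⟦ k ⟧) ∎
    where open ≡-Reasoning

  *F-assoc : ∀ a b c → (a *F b) *F c ≡ a *F (b *F c)
  *F-assoc a b c with reduce a | reduce b | reduce c
  ... | reduction m | reduction n | reduction k = begin
    (⟦ m ⟧ *F ⟦ n ⟧) *F ⟦ k ⟧ ≡⟨ cong (_*F ⟦ k ⟧) (⟦⟧-* m n) ⟩
    ⟦ m * n ⟧ *F ⟦ k ⟧        ≡⟨ ⟦⟧-* (m * n) k ⟩
    ⟦ m * n * k ⟧             ≡⟨ cong ⟦_⟧ (ℕ.*-assoc m n k) ⟩
    ⟦ m * (n * k) ⟧           ≡⟨ ⟦⟧-* m (n * k) ⟨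
    ⟦ m ⟧ *F ⟦ n * k ⟧        ≡⟨ cong (⟦ m ⟧ *F_) (⟦⟧-* n k) ⟨
    ⟦ m ⟧ *F (⟦ n ⟧ *F ⟦ k ⟧) ∎
    where open ≡-Reasoning

  *F-distribˡ-+F : ∀ a b c → a *F (b +F c) ≡ (a *F b) +F (a *F c)
  *F-distribˡ-+F a b c with reduce a | reduce b | reduce c
  ... | reduction m | reduction n | reduction k = begin
    ⟦ m ⟧ *F (⟦ n ⟧ +F ⟦ k ⟧)           ≡⟨ cong (⟦ m ⟧ *F_) (⟦⟧-+ n k) ⟩
    ⟦ m ⟧ *F ⟦ n + k ⟧                  ≡⟨ ⟦⟧-* m (n + k) ⟩
    ⟦ m * (n + k) ⟧                     ≡⟨ cong ⟦_⟧ (ℕ.*-distribˡ-+ m n k) ⟩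
    ⟦ m * n + m * k ⟧                   ≡⟨ ⟦⟧-+ (m * n) (m * k) ⟨
    ⟦ m * n ⟧ +F ⟦ m * k ⟧              ≡⟨ cong₂ _+F_ (⟦⟧-* m n) (⟦⟧-* m k) ⟨
    (⟦ m ⟧ *F ⟦ n ⟧) +F (⟦ m ⟧ *F ⟦ k ⟧) ∎
    where open ≡-Reasoning

  +F-identityˡ : ∀ a → 0F +F a ≡ a
  +F-identityˡ a with reduce a
  ... | reduction n = ⟦⟧-+ 0 n

  *F-identityˡ : ∀ a → 1F *F a ≡ a
  *F-identityˡ a with reduce a
  ... | reduction n = trans (⟦⟧-* 1 n) (cong ⟦_⟧ (ℕ.*-identityˡ n))

  -F-inverseˡ : ∀ a → (-F a) +F a ≡ 0F
  -F-inverseˡ a with reduce a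
  ... | reduction n = begin
    (⟦ r ∸ 1 ⟧ *F ⟦ n ⟧) +F ⟦ n ⟧ ≡⟨ cong (_+F ⟦ n ⟧) (⟦⟧-* (r ∸ 1) n) ⟩
    ⟦ (r ∸ 1) * n ⟧ +F ⟦ n ⟧      ≡⟨ ⟦⟧-+ ((r ∸ 1) * n) n ⟩
    ⟦ (r ∸ 1) * n + n ⟧           ≡⟨ cong ⟦_⟧ (ℕ.+-comm ((r ∸ 1) * n) n) ⟩
    ⟦ suc (r ∸ 1) * n ⟧           ≡⟨ cong (λ m → ⟦ m * n ⟧) (ℕ.suc-pred r) ⟩
    ⟦ r * n ⟧                     ≡⟨ ⟦r*n⟧≡0F n ⟩
    0F                            ∎
    where open ≡-Reasoning

  isCommutativeRing : IsCommutativeRing _≡_ _+F_ _*F_ -F_ 0F 1F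
  isCommutativeRing = record
    { isRing = record
      { +-isAbelianGroup = record
        { isGroup = record
          { isMonoid = record
            { isSemigroup = record
              { isMagma = record { isEquivalence = isEquivalence ; ∙-cong = cong₂ _+F_ }
              ; assoc = +F-assoc }
            ; identity = +F-identityˡ , λ a → trans (+F-comm a 0F) (+F-identityˡ a) }
          ; inverse = -F-inverseˡ , λ a → trans (+F-comm a (-F a)) (-F-inverseˡ a)
          ; ⁻¹-cong = cong -F_ }
        ; comm = +F-comm }
      ; *-cong = cong₂ _*F_
      ; *-assoc = *F-assoc
      ; *-identity = *F-identityˡ , λ a → trans (*F-comm a 1F) (*F-identityˡ a)
      ; distrib = *F-distribˡ-+F , λ a b c → trans (*F-comm (b +F c) a)
                    (trans (*F-distribˡ-+F a b c) (cong₂ _+F_ (*F-comm a b) (*F-comm a c))) }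
    ; *-comm = *F-comm }

  commutativeRing : CommutativeRing 0ℓ 0ℓ
  commutativeRing = record { isCommutativeRing = isCommutativeRing }

module _ {a ℓ} (M : Monoid a ℓ) where
  open Monoid M renaming (refl to ≈-refl; trans to ≈-trans)
  open MonoidSum M using (sum-cong-≋; sum-replicate-zero) renaming (sum to ∑)

  sum-pick : ∀ {n} (f : Fin n → Carrier) k → (∀ j → j ≢ k → f j ≈ ε) → ∑ f ≈ f k
  sum-pick {suc n} f fz vanish =
    ≈-trans (∙-congˡ (≈-trans (sum-cong-≋ (λ j → vanish (fs j) λ ())) (sum-replicate-zero n))) (identityʳ (f fz))
  sum-pick {suc n} f (fs k) vanish =
    ≈-trans (∙-cong (vanish fz λ ()) (sum-pick (f ∘ fs) k λ j j≢k → vanish (fs j) (j≢k ∘ Fin.suc-injective)))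
            (identityˡ (f (fs k)))

module _ {c ℓ} (R : Ring c ℓ) where
  open Ring R renaming (sym to ≈-sym; trans to ≈-trans)
  open SemiringSum semiring using () renaming (sum to ∑)
  open RingProperties R using (-0#≈0#; -‿+-comm)

  sum-neg : ∀ {n} (f : Fin n → Carrier) → ∑ (λ i → - f i) ≈ - ∑ f
  sum-neg {zero}  f = ≈-sym -0#≈0#
  sum-neg {suc n} f = ≈-trans (+-congˡ (sum-neg (f ∘ fs))) (-‿+-comm (f fz) _)

𝟙 : Bool → ℕ
𝟙 b = if b then 1 else 0

module ℕ-Sum where
  open Data.Nat using (_+_; _*_)

  sum-const : ∀ n k → ∑[ i < n ] k ≡ n * k
  sum-const zero    k = refl
  sum-const (suc n) k = cong (k +_) (sum-const n k)

  sum-zero : ∀ {n} {f : Fin n → ℕ} → (∀ i → f i ≡ 0) → sum f ≡ 0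
  sum-zero {n} f≡0 = trans (sum-cong-≗ f≡0) (trans (sum-const n 0) (ℕ.*-zeroʳ n))

  sum-mono-≤ : ∀ {n} {f g : Fin n → ℕ} → (∀ i → f i ≤ g i) → sum f ≤ sum g
  sum-mono-≤ {zero}  f≤g = z≤n
  sum-mono-≤ {suc n} f≤g = ℕ.+-mono-≤ (f≤g fz) (sum-mono-≤ (f≤g ∘ fs))

  +-mono-≤-≡⇒≡ : ∀ {a b c d} → a ≤ c → b ≤ d → a + b ≡ c + d → a ≡ c × b ≡ d
  +-mono-≤-≡⇒≡ {a} {b} {c} {d} a≤c b≤d eq =
      ℕ.≤-antisym a≤c (ℕ.+-cancelʳ-≤ b c a (ℕ.≤-trans (ℕ.+-monoʳ-≤ c b≤d) (ℕ.≤-reflexive (sym eq))))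
    , ℕ.≤-antisym b≤d (ℕ.+-cancelˡ-≤ a d b (ℕ.≤-trans (ℕ.+-monoˡ-≤ d a≤c) (ℕ.≤-reflexive (sym eq))))

  sum-mono-≤-≡⇒≗ : ∀ {n} {f g : Fin n → ℕ} → (∀ i → f i ≤ g i) → sum f ≡ sum g → ∀ i → f i ≡ g i
  sum-mono-≤-≡⇒≗ {suc n} f≤g eq fz     = proj₁ (+-mono-≤-≡⇒≡ (f≤g fz) (sum-mono-≤ (f≤g ∘ fs)) eq)
  sum-mono-≤-≡⇒≗ {suc n} f≤g eq (fs i) =
    sum-mono-≤-≡⇒≗ (f≤g ∘ fs) (proj₂ (+-mono-≤-≡⇒≡ (f≤g fz) (sum-mono-≤ (f≤g ∘ fs)) eq)) i

  sum-≤1 : ∀ {n} (f : Fin n → ℕ) → (∀ i → f i ≤ 1) → (∀ i j → 0 < f i → 0 < f j → i ≡ j) → sum f ≤ 1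
  sum-≤1 {zero}  f f≤1 unique = z≤n
  sum-≤1 {suc n} f f≤1 unique with f fz in eq
  ... | zero  = sum-≤1 (f ∘ fs) (f≤1 ∘ fs) (λ i j p q → Fin.suc-injective (unique (fs i) (fs j) p q))
  ... | suc k = begin
    suc k + sum (f ∘ fs)   ≡⟨ cong (suc k +_) rest≡0 ⟩
    suc k + 0              ≡⟨ ℕ.+-identityʳ (suc k) ⟩
    suc k                  ≡⟨ eq ⟨
    f fz                   ≤⟨ f≤1 fz ⟩
    1                      ∎
    where
    open ℕ.≤-Reasoning
    f0>0 : 0 < f fz
    f0>0 = subst (0 <_) (sym eq) (s≤s z≤n)
    rest≡0 : sum (f ∘ fs) ≡ 0
    rest≡0 = sum-zero (λ j → ℕ.n≤0⇒n≡0 (ℕ.≮⇒≥ λ fj>0 → Fin.0≢1+n (unique fz (fs j) f0>0 fj>0)))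

  sum>0⇒∃ : ∀ {n} (f : Fin n → ℕ) → 0 < sum f → ∃ λ i → 0 < f i
  sum>0⇒∃ {suc n} f pos with f fz in eq
  ... | suc _ = fz , subst (0 <_) (sym eq) (s≤s z≤n)
  ... | zero with sum>0⇒∃ (f ∘ fs) pos
  ...   | i , fi>0 = fs i , fi>0

  𝟙≤1 : ∀ b → 𝟙 b ≤ 1
  𝟙≤1 true  = s≤s z≤n
  𝟙≤1 false = z≤n

  𝟙-not : ∀ b → 𝟙 (not b) + 𝟙 b ≡ 1
  𝟙-not true  = refl
  𝟙-not false = refl

  𝟙-not-* : ∀ b m → 𝟙 (not b) * m + 𝟙 b * m ≡ m
  𝟙-not-* true  m = ℕ.+-identityʳ m
  𝟙-not-* false m = trans (ℕ.+-identityʳ (m + 0)) (ℕ.+-identityʳ m)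

  sum-𝟙-not-* : ∀ {n} (p : Fin n → Bool) (f : Fin n → ℕ) →
                ∑[ i < n ] (𝟙 (not (p i)) * f i) ≡ sum f ∸ ∑[ i < n ] (𝟙 (p i) * f i)
  sum-𝟙-not-* {n} p f = trans (sym (ℕ.m+n∸n≡m (∑[ i < n ] (𝟙 (not (p i)) * f i)) (∑[ i < n ] (𝟙 (p i) * f i))))
    (cong (_∸ ∑[ i < n ] (𝟙 (p i) * f i))
      (trans (sym (∑-distrib-+ (λ i → 𝟙 (not (p i)) * f i) (λ i → 𝟙 (p i) * f i)))
             (sum-cong-≗ (λ i → 𝟙-not-* (p i) (f i)))))

  sum-𝟙-not : ∀ {n} (p : Fin n → Bool) → ∑[ i < n ] 𝟙 (not (p i)) ≡ n ∸ ∑[ i < n ] 𝟙 (p i)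
  sum-𝟙-not {n} p = begin
    ∑[ i < n ] 𝟙 (not (p i))                     ≡⟨ sum-cong-≗ (λ i → ℕ.*-identityʳ (𝟙 (not (p i)))) ⟨
    ∑[ i < n ] (𝟙 (not (p i)) * 1)               ≡⟨ sum-𝟙-not-* p (λ _ → 1) ⟩
    ∑[ i < n ] 1 ∸ ∑[ i < n ] (𝟙 (p i) * 1)      ≡⟨ cong₂ _∸_ (trans (sum-const n 1) (ℕ.*-identityʳ n))
                                                                 (sum-cong-≗ (λ i → ℕ.*-identityʳ (𝟙 (p i)))) ⟩
    n ∸ ∑[ i < n ] 𝟙 (p i)                       ∎
    where open ≡-Reasoning

  sum-↑ : ∀ m n (f : Fin (m + n) → ℕ) → sum f ≡ ∑[ i < m ] f (i ↑ˡ n) + ∑[ j < n ] f (m ↑ʳ j)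
  sum-↑ zero    n f = refl
  sum-↑ (suc m) n f = trans (cong (f fz +_) (sum-↑ m n (f ∘ fs))) (sym (ℕ.+-assoc (f fz) _ _))

  sum-combine : ∀ m n (f : Fin (m * n) → ℕ) → sum f ≡ ∑[ i < m ] ∑[ j < n ] f (combine i j)
  sum-combine zero    n f = refl
  sum-combine (suc m) n f =
    trans (sum-↑ n (m * n) f) (cong (∑[ j < n ] f (j ↑ˡ (m * n)) +_) (sum-combine m n (λ k → f (n ↑ʳ k))))

  length-filter-tabulate : ∀ {A : Set} {n} (p : A → Bool) (f : Fin n → A) →
                           length (filter (T? ∘ p) (List.tabulate f)) ≡ ∑[ i < n ] 𝟙 (p (f i))
  length-filter-tabulate {n = zero}  p f = refl
  length-filter-tabulate {n = suc n} p f with p (f fz)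
  ... | true  = cong suc (length-filter-tabulate p (f ∘ fs))
  ... | false = length-filter-tabulate p (f ∘ fs)

module PrimeField (r : ℕ) {{_ : NonZero r}} (r-prime : Prime r) where
  open Data.Nat using (_+_; _*_)
  open ResidueRing r public

  module 𝔽 = CommutativeRing commutativeRing
  module 𝔽-Props = RingProperties 𝔽.ring

  infix 4 _≟F_
  _≟F_ : (a b : Fin r) → Dec (a ≡ b)
  _≟F_ = Fin._≟_

  isZero : Fin r → Bool
  isZero a = does (a ≟F 0F)

  toℕ-0F : toℕ 0F ≡ 0
  toℕ-0F = trans (toℕ-⟦⟧ 0) (m<n⇒m%n≡m (ℕ.>-nonZero⁻¹ r))

  toℕ≡0⇒≡0F : ∀ a → toℕ a ≡ 0 → a ≡ 0F
  toℕ≡0⇒≡0F a eq = trans (sym (⟦toℕ⟧ a)) (cong ⟦_⟧ eq)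

  r∣toℕ⇒≡0F : ∀ a → r ∣ toℕ a → a ≡ 0F
  r∣toℕ⇒≡0F a r∣a = toℕ≡0⇒≡0F a (small-multiple (Fin.toℕ<n a))
    where
    small-multiple : toℕ a < r → toℕ a ≡ 0
    small-multiple a<r with toℕ a
    ... | zero  = refl
    ... | suc m = ⊥-elim (>⇒∤ a<r r∣a)

  x*y≡0⇒x≡0⊎y≡0 : ∀ a b → a *F b ≡ 0F → a ≡ 0F ⊎ b ≡ 0F
  x*y≡0⇒x≡0⊎y≡0 a b ab≡0 with euclidsLemma (toℕ a) (toℕ b) r-prime r∣ab
    where
    r∣ab : r ∣ toℕ a * toℕ b
    r∣ab = m%n≡0⇒n∣m _ r (trans (sym (toℕ-⟦⟧ (toℕ a * toℕ b))) (trans (cong toℕ ab≡0) toℕ-0F))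
  ... | inj₁ r∣a = inj₁ (r∣toℕ⇒≡0F a r∣a)
  ... | inj₂ r∣b = inj₂ (r∣toℕ⇒≡0F b r∣b)

  *F-inverse : ∀ a → a ≢ 0F → ∃ λ b → a *F b ≡ 1F
  *F-inverse a a≢0 = from-Bézout (coprime-Bézout (prime⇒coprime r-prime {{toℕa≢0}} (Fin.toℕ<n a)))
    where
    open ≡-Reasoning
    toℕa≢0 : NonZero (toℕ a)
    toℕa≢0 = ℕ.≢-nonZero (a≢0 ∘ toℕ≡0⇒≡0F a)
    a*⟦_⟧ : ∀ y → a *F ⟦ y ⟧ ≡ ⟦ y * toℕ a ⟧
    a*⟦ y ⟧ = trans (cong (_*F ⟦ y ⟧) (sym (⟦toℕ⟧ a)))
                    (trans (⟦⟧-* (toℕ a) y) (cong ⟦_⟧ (ℕ.*-comm (toℕ a) y)))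
    from-Bézout : Bézout.Identity 1 r (toℕ a) → ∃ λ b → a *F b ≡ 1F
    from-Bézout (Bézout.-+ x y eq) = ⟦ y ⟧ , (begin
      a *F ⟦ y ⟧     ≡⟨ a*⟦ y ⟧ ⟩
      ⟦ y * toℕ a ⟧  ≡⟨ cong ⟦_⟧ eq ⟨
      ⟦ 1 + x * r ⟧  ≡⟨ ⟦⟧-cong-% ([m+kn]%n≡m%n 1 x r) ⟩
      1F             ∎)
    from-Bézout (Bézout.+- x y eq) = -F ⟦ y ⟧ , (begin
      a *F (-F ⟦ y ⟧)  ≡⟨ 𝔽-Props.-‿distribʳ-* a ⟦ y ⟧ ⟨
      -F (a *F ⟦ y ⟧)  ≡⟨ cong -F_ (𝔽-Props.+-inverseʳ-unique 1F (a *F ⟦ y ⟧) 1+ay≡0) ⟩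
      -F (-F 1F)       ≡⟨ 𝔽-Props.-‿involutive 1F ⟩
      1F               ∎)
      where
      1+ay≡0 : 1F +F (a *F ⟦ y ⟧) ≡ 0F
      1+ay≡0 = begin
        1F +F (a *F ⟦ y ⟧)      ≡⟨ cong (1F +F_) a*⟦ y ⟧ ⟩
        1F +F ⟦ y * toℕ a ⟧     ≡⟨ ⟦⟧-+ 1 (y * toℕ a) ⟩
        ⟦ 1 + y * toℕ a ⟧       ≡⟨ cong ⟦_⟧ (trans eq (ℕ.*-comm x r)) ⟩
        ⟦ r * x ⟧               ≡⟨ ⟦r*n⟧≡0F x ⟩
        0F                      ∎

  *F-cancelˡ : ∀ {c x y} → c ≢ 0F → c *F x ≡ c *F y → x ≡ y
  *F-cancelˡ {c} {x} {y} c≢0 cx≡cy = begin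
    x                  ≡⟨ *F-identityˡ x ⟨
    1F *F x            ≡⟨ cong (_*F x) c⁻¹c≡1 ⟨
    (c⁻¹ *F c) *F x    ≡⟨ *F-assoc c⁻¹ c x ⟩
    c⁻¹ *F (c *F x)    ≡⟨ cong (c⁻¹ *F_) cx≡cy ⟩
    c⁻¹ *F (c *F y)    ≡⟨ *F-assoc c⁻¹ c y ⟨
    (c⁻¹ *F c) *F y    ≡⟨ cong (_*F y) c⁻¹c≡1 ⟩
    1F *F y            ≡⟨ *F-identityˡ y ⟩
    y                  ∎
    where
    open ≡-Reasoning
    c⁻¹ = proj₁ (*F-inverse c c≢0)
    c⁻¹c≡1 : c⁻¹ *F c ≡ 1F
    c⁻¹c≡1 = trans (*F-comm c⁻¹ c) (proj₂ (*F-inverse c c≢0))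

  *F-≢0 : ∀ {a b} → a ≢ 0F → b ≢ 0F → a *F b ≢ 0F
  *F-≢0 {a} {b} a≢0 b≢0 ab≡0 = [ a≢0 , b≢0 ]′ (x*y≡0⇒x≡0⊎y≡0 a b ab≡0)

  -F-≢0 : ∀ {a} → a ≢ 0F → -F a ≢ 0F
  -F-≢0 {a} a≢0 -a≡0 = a≢0 (trans (sym (𝔽-Props.-‿involutive a)) (trans (cong -F_ -a≡0) 𝔽-Props.-0#≈0#))

  isZero-*F : ∀ {c} → c ≢ 0F → ∀ y → isZero (c *F y) ≡ isZero y
  isZero-*F {c} c≢0 y = does-⇔ (mk⇔ cy≡0⇒y≡0 (λ y≡0 → trans (cong (c *F_) y≡0) (𝔽.zeroʳ c))) (c *F y ≟F 0F) (y ≟F 0F)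
    where
    cy≡0⇒y≡0 : c *F y ≡ 0F → y ≡ 0F
    cy≡0⇒y≡0 cy≡0 = [ ⊥-elim ∘ c≢0 , (λ y≡0 → y≡0) ]′ (x*y≡0⇒x≡0⊎y≡0 c y cy≡0)

module LinearAlgebra (r : ℕ) {{_ : NonZero r}} (r-prime : Prime r) where
  open Data.Nat using (_+_; _*_)
  open PrimeField r r-prime public
  open ℕ-Sum public
  module ΣF = SemiringSum 𝔽.semiring

  1<r : 1 < r
  1<r = ℕ.nonTrivial⇒n>1 r {{prime⇒nonTrivial r-prime}}

  infix 4 _≟ᵥ_
  _≟ᵥ_ : ∀ {n} (u v : Point r n) → Dec (u ≡ v)
  _≟ᵥ_ = Vec.≡-dec _≟F_

  lookup-ext : ∀ {A : Set} {n} {u v : Vec A n} → (∀ i → lookup u i ≡ lookup v i) → u ≡ v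
  lookup-ext {u = u} {v} eq = trans (sym (Vec.tabulate∘lookup u)) (trans (Vec.tabulate-cong eq) (Vec.tabulate∘lookup v))

  lookup-0P : ∀ {n} i → lookup (0P {r} {n}) i ≡ 0F
  lookup-0P i = Vec.lookup-replicate i 0F

  ≢0P⇒∃lookup≢0F : ∀ {n} (v : Point r n) → v ≢ 0P → ∃ λ i → lookup v i ≢ 0F
  ≢0P⇒∃lookup≢0F {n} v v≢0 = Fin.¬∀⟶∃¬ n _ (λ i → lookup v i ≟F 0F)
    (λ all-zero → v≢0 (lookup-ext (λ i → trans (all-zero i) (sym (lookup-0P i)))))

  lookup-+P : ∀ {n} (u v : Point r n) i → lookup (u +P v) i ≡ lookup u i +F lookup v i
  lookup-+P u v i = Vec.lookup-zipWith _+F_ i u v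

  lookup-·P : ∀ {n} c (u : Point r n) i → lookup (c ·P u) i ≡ c *F lookup u i
  lookup-·P c u i = Vec.lookup-map i (c *F_) u

  lookup-lincomb : ∀ {t m} (c : Fin m → Fin r) (b : Fin m → Point r t) i →
                   lookup (lincomb c b) i ≡ ΣF.sum (λ k → c k *F lookup (b k) i)
  lookup-lincomb {m = zero}  c b i = lookup-0P i
  lookup-lincomb {m = suc m} c b i =
    trans (lookup-+P (c fz ·P b fz) _ i) (cong₂ _+F_ (lookup-·P (c fz) (b fz) i) (lookup-lincomb (c ∘ fs) (b ∘ fs) i))

  lookup-lincomb-sub : ∀ {t m} (d₁ d₂ : Fin m → Fin r) (v : Fin m → Point r t) i →
                       lookup (lincomb (λ j → d₁ j +F (-F d₂ j)) v) i ≡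
                       lookup (lincomb d₁ v) i +F (-F lookup (lincomb d₂ v) i)
  lookup-lincomb-sub d₁ d₂ v i = begin
    lookup (lincomb (λ j → d₁ j +F (-F d₂ j)) v) i
      ≡⟨ lookup-lincomb (λ j → d₁ j +F (-F d₂ j)) v i ⟩
    ΣF.sum (λ j → (d₁ j +F (-F d₂ j)) *F lookup (v j) i)
      ≡⟨ ΣF.sum-cong-≗ (λ j → 𝔽-Props.[y-z]x≈yx-zx (lookup (v j) i) (d₁ j) (d₂ j)) ⟩
    ΣF.sum (λ j → (d₁ j *F lookup (v j) i) +F (-F (d₂ j *F lookup (v j) i)))
      ≡⟨ ΣF.∑-distrib-+ (λ j → d₁ j *F lookup (v j) i) (λ j → -F (d₂ j *F lookup (v j) i)) ⟩
    ΣF.sum (λ j → d₁ j *F lookup (v j) i) +F ΣF.sum (λ j → -F (d₂ j *F lookup (v j) i))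
      ≡⟨ cong (ΣF.sum (λ j → d₁ j *F lookup (v j) i) +F_) (sum-neg 𝔽.ring (λ j → d₂ j *F lookup (v j) i)) ⟩
    ΣF.sum (λ j → d₁ j *F lookup (v j) i) +F (-F ΣF.sum (λ j → d₂ j *F lookup (v j) i))
      ≡⟨ cong₂ (λ p q → p +F (-F q)) (lookup-lincomb d₁ v i) (lookup-lincomb d₂ v i) ⟨
    lookup (lincomb d₁ v) i +F (-F lookup (lincomb d₂ v) i) ∎
    where open ≡-Reasoning

  dot : ∀ {n} → Point r n → Point r n → Fin r
  dot u v = ΣF.sum (λ i → lookup u i *F lookup v i)

  dot-comm : ∀ {n} (u v : Point r n) → dot u v ≡ dot v u
  dot-comm u v = ΣF.sum-cong-≗ (λ i → *F-comm (lookup u i) (lookup v i))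

  dot-0Pˡ : ∀ {n} (x : Point r n) → dot 0P x ≡ 0F
  dot-0Pˡ {n} x = trans (ΣF.sum-cong-≗ (λ i → trans (cong (_*F lookup x i) (lookup-0P i)) (𝔽.zeroˡ (lookup x i))))
                        (ΣF.sum-replicate-zero n)

  dot-·Pˡ : ∀ {n} c (u x : Point r n) → dot (c ·P u) x ≡ c *F dot u x
  dot-·Pˡ c u x = trans
    (ΣF.sum-cong-≗ (λ i → trans (cong (_*F lookup x i) (lookup-·P c u i)) (*F-assoc c (lookup u i) (lookup x i))))
    (sym (ΣF.*-distribˡ-sum c (λ i → lookup u i *F lookup x i)))

  dot-+Pˡ : ∀ {n} (u v x : Point r n) → dot (u +P v) x ≡ dot u x +F dot v x
  dot-+Pˡ u v x = trans
    (ΣF.sum-cong-≗ (λ i → trans (cong (_*F lookup x i) (lookup-+P u v i))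
                                (𝔽.distribʳ (lookup x i) (lookup u i) (lookup v i))))
    (ΣF.∑-distrib-+ (λ i → lookup u i *F lookup x i) (λ i → lookup v i *F lookup x i))

  dot-lincombʳ : ∀ {t m} (a : Point r t) (e : Fin m → Fin r) (b : Fin m → Point r t) →
                 dot a (lincomb e b) ≡ ΣF.sum (λ k → e k *F dot a (b k))
  dot-lincombʳ a e b = begin
    ΣF.sum (λ i → lookup a i *F lookup (lincomb e b) i)
      ≡⟨ ΣF.sum-cong-≗ (λ i → cong (lookup a i *F_) (lookup-lincomb e b i)) ⟩
    ΣF.sum (λ i → lookup a i *F ΣF.sum (λ k → e k *F lookup (b k) i))
      ≡⟨ ΣF.sum-cong-≗ (λ i → ΣF.*-distribˡ-sum (lookup a i) (λ k → e k *F lookup (b k) i)) ⟩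
    ΣF.sum (λ i → ΣF.sum (λ k → lookup a i *F (e k *F lookup (b k) i)))
      ≡⟨ ΣF.∑-comm (λ i k → lookup a i *F (e k *F lookup (b k) i)) ⟩
    ΣF.sum (λ k → ΣF.sum (λ i → lookup a i *F (e k *F lookup (b k) i)))
      ≡⟨ ΣF.sum-cong-≗ (λ k → ΣF.sum-cong-≗ (λ i → x∙yz≈y∙xz (lookup a i) (e k) (lookup (b k) i))) ⟩
    ΣF.sum (λ k → ΣF.sum (λ i → e k *F (lookup a i *F lookup (b k) i)))
      ≡⟨ ΣF.sum-cong-≗ (λ k → sym (ΣF.*-distribˡ-sum (e k) (λ i → lookup a i *F lookup (b k) i))) ⟩
    ΣF.sum (λ k → e k *F dot a (b k)) ∎
    where
    open ≡-Reasoning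
    open CommutativeSemigroupProperties 𝔽.*-commutativeSemigroup using (x∙yz≈y∙xz)

  unit : ∀ {n} → Fin n → Point r n
  unit j = tabulate (λ i → if does (i Fin.≟ j) then 1F else 0F)

  dot-unitʳ : ∀ {n} (a : Point r n) j → dot a (unit j) ≡ lookup a j
  dot-unitʳ a j = trans (sum-pick 𝔽.+-monoid _ j off-j) (trans (cong (lookup a j *F_) on-j) (𝔽.*-identityʳ (lookup a j)))
    where
    unit-entry : ∀ i → lookup (unit j) i ≡ (if does (i Fin.≟ j) then 1F else 0F)
    unit-entry i = Vec.lookup∘tabulate _ i
    on-j : lookup (unit j) j ≡ 1F
    on-j = trans (unit-entry j) (cong (if_then 1F else 0F) (dec-true (j Fin.≟ j) refl))
    off-j : ∀ i → i ≢ j → lookup a i *F lookup (unit j) i ≡ 0F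
    off-j i i≢j = trans (cong (lookup a i *F_)
                          (trans (unit-entry i) (cong (if_then 1F else 0F) (dec-false (i Fin.≟ j) i≢j))))
                        (𝔽.zeroʳ (lookup a i))

  encode : ∀ {k} → Point r k → Fin (r ^ k)
  encode []      = fz
  encode (a ∷ v) = combine a (encode v)

  decode : ∀ k → Fin (r ^ k) → Point r k
  decode zero    _ = []
  decode (suc k) x = proj₁ (remQuot {r} (r ^ k) x) ∷ decode k (proj₂ (remQuot {r} (r ^ k) x))

  decode-combine : ∀ k a y → decode (suc k) (combine a y) ≡ a ∷ decode k y
  decode-combine k a y = cong (λ p → proj₁ p ∷ decode k (proj₂ p)) (Fin.remQuot-combine {r} {r ^ k} a y)

  decode-encode : ∀ {k} (v : Point r k) → decode k (encode v) ≡ v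
  decode-encode []               = refl
  decode-encode {suc k} (a ∷ v)  = trans (decode-combine k a (encode v)) (cong (a ∷_) (decode-encode v))

  encode-decode : ∀ k (x : Fin (r ^ k)) → encode (decode k x) ≡ x
  encode-decode zero    fz = refl
  encode-decode (suc k) x  =
    trans (cong (combine (proj₁ (remQuot {r} (r ^ k) x))) (encode-decode k _)) (Fin.combine-remQuot {r} (r ^ k) x)

  ∑ᵥ : ∀ {n} → (Point r n → ℕ) → ℕ
  ∑ᵥ {n} f = ∑[ k < r ^ n ] f (decode n k)

  ∑ᵥ-cong : ∀ {n} {f g : Point r n → ℕ} → (∀ x → f x ≡ g x) → ∑ᵥ f ≡ ∑ᵥ g
  ∑ᵥ-cong {n} f≗g = sum-cong-≗ (f≗g ∘ decode n)

  ∑ᵥ-+ : ∀ {n} (f g : Point r n → ℕ) → ∑ᵥ (λ x → f x + g x) ≡ ∑ᵥ f + ∑ᵥ g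
  ∑ᵥ-+ {n} f g = ∑-distrib-+ (f ∘ decode n) (g ∘ decode n)

  ∑ᵥ-*ˡ : ∀ {n} c (f : Point r n → ℕ) → ∑ᵥ (λ x → c * f x) ≡ c * ∑ᵥ f
  ∑ᵥ-*ˡ {n} c f = sym (*-distribˡ-sum c (f ∘ decode n))

  ∑-∑ᵥ-comm : ∀ {m n} (f : Fin m → Point r n → ℕ) → ∑[ l < m ] ∑ᵥ (f l) ≡ ∑ᵥ (λ x → ∑[ l < m ] f l x)
  ∑-∑ᵥ-comm {n = n} f = ∑-comm (λ l k → f l (decode n k))

  ∑ᵥ-[] : (f : Point r 0 → ℕ) → ∑ᵥ f ≡ f []
  ∑ᵥ-[] f = ℕ.+-identityʳ (f [])

  ∑ᵥ-∷ : ∀ {n} (f : Point r (suc n) → ℕ) → ∑ᵥ f ≡ ∑[ a < r ] ∑ᵥ (λ v → f (a ∷ v))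
  ∑ᵥ-∷ {n} f = trans (sum-combine r (r ^ n) (f ∘ decode (suc n)))
    (sum-cong-≗ (λ a → sum-cong-≗ (λ y → cong f (decode-combine n a y))))

  ∑ᵥ-pick : ∀ {n} (f : Point r n → ℕ) v → (∀ w → w ≢ v → f w ≡ 0) → ∑ᵥ f ≡ f v
  ∑ᵥ-pick {n} f v vanish = trans (sum-pick ℕ.+-0-monoid (f ∘ decode n) (encode v) off-v) (cong f (decode-encode v))
    where
    off-v : ∀ k → k ≢ encode v → f (decode n k) ≡ 0
    off-v k k≢v = vanish (decode n k) (λ eq → k≢v (trans (sym (encode-decode n k)) (cong encode eq)))

  ∑-pointEnum : ∀ {t} {P : Fin (r ^ t) → Point r t} → IsPointEnum P → ∀ f → ∑[ j < r ^ t ] f (P j) ≡ ∑ᵥ f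
  ∑-pointEnum {t} {P} (P-injective , P-surjective) f =
    sym (trans (∑-permute (f ∘ decode t) π) (sum-cong-≗ (cong f ∘ decode-encode ∘ P)))
    where
    π = mk↔ₛ′ (encode ∘ P) (λ k → proj₁ (P-surjective (decode t k)))
          (λ k → trans (cong encode (proj₂ (P-surjective (decode t k)))) (encode-decode t k))
          (λ j → P-injective _ _ (trans (proj₂ (P-surjective (decode t (encode (P j))))) (decode-encode (P j))))

  ·P-cancelʳ : ∀ {n} {l l′} {v : Point r n} → v ≢ 0P → l ·P v ≡ l′ ·P v → l ≡ l′
  ·P-cancelʳ {l = l} {l′} {v} v≢0 eq with j , vj≢0 ← ≢0P⇒∃lookup≢0F v v≢0 =
    *F-cancelˡ vj≢0 (trans (*F-comm (lookup v j) l) (trans lj≡l′j (*F-comm l′ (lookup v j))))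
    where
    lj≡l′j : l *F lookup v j ≡ l′ *F lookup v j
    lj≡l′j = trans (sym (lookup-·P l v j)) (trans (cong (λ w → lookup w j) eq) (lookup-·P l′ v j))

  ·P-≢0P : ∀ {n} {l} {v : Point r n} → l ≢ 0F → v ≢ 0P → l ·P v ≢ 0P
  ·P-≢0P {l = l} {v} l≢0 v≢0 lv≡0 with j , vj≢0 ← ≢0P⇒∃lookup≢0F v v≢0 =
    *F-≢0 l≢0 vj≢0 (trans (sym (lookup-·P l v j)) (trans (cong (λ w → lookup w j) lv≡0) (lookup-0P j)))

  linearDependence : ∀ {m n} → m < n → (v : Fin n → Point r m) →
                     ∃ λ c → (∃ λ j → c j ≢ 0F) × lincomb c v ≡ 0P
  -- Pigeonhole: r^n coefficient vectors, but only r^m possible values of the combination.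
  linearDependence {m} {n} m<n v = from-collision (Fin.pigeonhole (ℕ.^-monoʳ-< r 1<r m<n) (encode ∘ image))
    where
    image : Fin (r ^ n) → Point r m
    image k = lincomb (lookup (decode n k)) v
    from-collision : (∃₂ λ k₁ k₂ → k₁ Fin.< k₂ × encode (image k₁) ≡ encode (image k₂)) →
                     ∃ λ c → (∃ λ j → c j ≢ 0F) × lincomb c v ≡ 0P
    from-collision (k₁ , k₂ , k₁<k₂ , same-code) = c , nonzero , lookup-ext c-kills
      where
      open ≡-Reasoning
      d₁ d₂ c : Fin n → Fin r
      d₁ = lookup (decode n k₁)
      d₂ = lookup (decode n k₂)
      c j = d₁ j +F (-F d₂ j)
      coefficients-differ : ¬ (∀ j → d₁ j ≡ d₂ j)
      coefficients-differ same = Fin.<-irrefl (begin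
        k₁                     ≡⟨ encode-decode n k₁ ⟨
        encode (decode n k₁)   ≡⟨ cong encode (lookup-ext {u = decode n k₁} {decode n k₂} same) ⟩
        encode (decode n k₂)   ≡⟨ encode-decode n k₂ ⟩
        k₂                     ∎) k₁<k₂
      nonzero : ∃ λ j → c j ≢ 0F
      nonzero with j , d₁j≢d₂j ← Fin.¬∀⟶∃¬ n _ (λ j → d₁ j ≟F d₂ j) coefficients-differ
        = j , d₁j≢d₂j ∘ 𝔽-Props.x∙y⁻¹≈ε⇒x≈y (d₁ j) (d₂ j)
      same-image : image k₁ ≡ image k₂
      same-image = trans (sym (decode-encode (image k₁))) (trans (cong (decode m) same-code) (decode-encode (image k₂)))
      c-kills : ∀ i → lookup (lincomb c v) i ≡ lookup 0P i
      c-kills i = begin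
        lookup (lincomb c v) i                            ≡⟨ lookup-lincomb-sub d₁ d₂ v i ⟩
        lookup (image k₁) i +F (-F lookup (image k₂) i)   ≡⟨ cong (λ w → lookup w i +F (-F lookup (image k₂) i)) same-image ⟩
        lookup (image k₂) i +F (-F lookup (image k₂) i)   ≡⟨ 𝔽.-‿inverseʳ (lookup (image k₂) i) ⟩
        0F                                                ≡⟨ lookup-0P i ⟨
        lookup 0P i                                       ∎

  transpose : ∀ {m n} → (Fin m → Point r n) → Fin n → Point r m
  transpose b j = tabulate (λ k → lookup (b k) j)

  orthogonal-vector : ∀ {m} (b : Fin m → Point r (suc m)) → ∃ λ a → a ≢ 0P × (∀ k → dot a (b k) ≡ 0F)
  orthogonal-vector {m} b = from-dependence (linearDependence (ℕ.n<1+n m) (transpose b))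
    where
    from-dependence : (∃ λ c → (∃ λ j → c j ≢ 0F) × lincomb c (transpose b) ≡ 0P) →
                      ∃ λ a → a ≢ 0P × (∀ k → dot a (b k) ≡ 0F)
    from-dependence (c , (j , cj≢0) , c-kills) = tabulate c , a≢0 , orthogonal
      where
      a≢0 : tabulate c ≢ 0P
      a≢0 a≡0 = cj≢0 (trans (sym (Vec.lookup∘tabulate c j)) (trans (cong (λ a → lookup a j) a≡0) (lookup-0P j)))
      orthogonal : ∀ k → dot (tabulate c) (b k) ≡ 0F
      orthogonal k = begin
        ΣF.sum (λ j → lookup (tabulate c) j *F lookup (b k) j)
          ≡⟨ ΣF.sum-cong-≗ (λ j → cong₂ _*F_ (Vec.lookup∘tabulate c j)
                                          (sym (Vec.lookup∘tabulate (λ k′ → lookup (b k′) j) k))) ⟩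
        ΣF.sum (λ j → c j *F lookup (transpose b j) k)
          ≡⟨ lookup-lincomb c (transpose b) k ⟨
        lookup (lincomb c (transpose b)) k
          ≡⟨ cong (λ w → lookup w k) c-kills ⟩
        lookup 0P k
          ≡⟨ lookup-0P k ⟩
        0F ∎
        where open ≡-Reasoning

  ΣF-zero : ∀ {n} {f : Fin n → Fin r} → (∀ k → f k ≡ 0F) → ΣF.sum f ≡ 0F
  ΣF-zero {n} f≡0 = trans (ΣF.sum-cong-≗ f≡0) (ΣF.sum-replicate-zero n)

  span⊆kernel : ∀ {t m} {a : Point r t} {b : Fin m → Point r t} → (∀ k → dot a (b k) ≡ 0F) →
                ∀ {x} → (∃ λ e → lincomb e b ≡ x) → dot a x ≡ 0F
  span⊆kernel {a = a} {b} a⊥b (e , refl) =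
    trans (dot-lincombʳ a e b) (ΣF-zero (λ k → trans (cong (e k *F_) (a⊥b k)) (𝔽.zeroʳ (e k))))

  lincomb-solve : ∀ {t m} c c⁻¹ (x : Point r t) (e : Fin m → Fin r) (b : Fin m → Point r t) → c⁻¹ *F c ≡ 1F →
                  (∀ i → (c *F lookup x i) +F lookup (lincomb e b) i ≡ 0F) →
                  lincomb (λ k → -F (c⁻¹ *F e k)) b ≡ x
  lincomb-solve c c⁻¹ x e b c⁻¹c≡1 relation = lookup-ext λ i → begin
    lookup (lincomb (λ k → -F (c⁻¹ *F e k)) b) i
      ≡⟨ lookup-lincomb (λ k → -F (c⁻¹ *F e k)) b i ⟩
    ΣF.sum (λ k → (-F (c⁻¹ *F e k)) *F lookup (b k) i)
      ≡⟨ ΣF.sum-cong-≗ (λ k → trans (sym (𝔽-Props.-‿distribˡ-* (c⁻¹ *F e k) (lookup (b k) i)))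
                                    (cong -F_ (*F-assoc c⁻¹ (e k) (lookup (b k) i)))) ⟩
    ΣF.sum (λ k → -F (c⁻¹ *F (e k *F lookup (b k) i)))
      ≡⟨ sum-neg 𝔽.ring (λ k → c⁻¹ *F (e k *F lookup (b k) i)) ⟩
    -F ΣF.sum (λ k → c⁻¹ *F (e k *F lookup (b k) i))
      ≡⟨ cong -F_ (ΣF.*-distribˡ-sum c⁻¹ (λ k → e k *F lookup (b k) i)) ⟨
    -F (c⁻¹ *F ΣF.sum (λ k → e k *F lookup (b k) i))
      ≡⟨ cong (λ y → -F (c⁻¹ *F y)) (lookup-lincomb e b i) ⟨
    -F (c⁻¹ *F lookup (lincomb e b) i)
      ≡⟨ cong (λ y → -F (c⁻¹ *F y)) (𝔽-Props.+-inverseʳ-unique (c *F lookup x i) (lookup (lincomb e b) i) (relation i)) ⟩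
    -F (c⁻¹ *F (-F (c *F lookup x i)))
      ≡⟨ cong -F_ (𝔽-Props.-‿distribʳ-* c⁻¹ (c *F lookup x i)) ⟨
    -F (-F (c⁻¹ *F (c *F lookup x i)))
      ≡⟨ 𝔽-Props.-‿involutive (c⁻¹ *F (c *F lookup x i)) ⟩
    c⁻¹ *F (c *F lookup x i)
      ≡⟨ *F-assoc c⁻¹ c (lookup x i) ⟨
    (c⁻¹ *F c) *F lookup x i
      ≡⟨ cong (_*F lookup x i) c⁻¹c≡1 ⟩
    1F *F lookup x i
      ≡⟨ *F-identityˡ (lookup x i) ⟩
    lookup x i ∎
    where open ≡-Reasoning

  relation-pairing : ∀ {t m} (a x e : Point r t) (b : Fin m → Point r t) (d : Fin (suc (suc m)) → Fin r) →
                     dot a x ≡ 0F → (∀ k → dot a (b k) ≡ 0F) → dot a e ≢ 0F →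
                     lincomb d (x Vecᶠ.∷ (e Vecᶠ.∷ b)) ≡ 0P → d (fs fz) ≡ 0F
  relation-pairing a x e b d a⊥x a⊥b a·e≢0 d-kills =
    [ (λ d₁≡0 → d₁≡0) , ⊥-elim ∘ a·e≢0 ]′ (x*y≡0⇒x≡0⊎y≡0 (d (fs fz)) (dot a e) (begin
      d (fs fz) *F dot a e
        ≡⟨ trans (sym (𝔽.+-identityˡ (d (fs fz) *F dot a e))) (cong (0F +F_) (sym (𝔽.+-identityʳ (d (fs fz) *F dot a e)))) ⟩
      0F +F ((d (fs fz) *F dot a e) +F 0F)
        ≡⟨ cong₂ _+F_ x-term (cong ((d (fs fz) *F dot a e) +F_) b-terms) ⟨
      (d fz *F dot a x) +F ((d (fs fz) *F dot a e) +F ΣF.sum (λ k → d (fs (fs k)) *F dot a (b k)))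
        ≡⟨ dot-lincombʳ a d (x Vecᶠ.∷ (e Vecᶠ.∷ b)) ⟨
      dot a (lincomb d (x Vecᶠ.∷ (e Vecᶠ.∷ b)))
        ≡⟨ cong (dot a) d-kills ⟩
      dot a 0P
        ≡⟨ trans (dot-comm a 0P) (dot-0Pˡ a) ⟩
      0F ∎))
    where
    open ≡-Reasoning
    x-term : d fz *F dot a x ≡ 0F
    x-term = trans (cong (d fz *F_) a⊥x) (𝔽.zeroʳ (d fz))
    b-terms : ΣF.sum (λ k → d (fs (fs k)) *F dot a (b k)) ≡ 0F
    b-terms = ΣF-zero (λ k → trans (cong (d (fs (fs k)) *F_) (a⊥b k)) (𝔽.zeroʳ (d (fs (fs k)))))

  lookup-lincomb-skip : ∀ {t m} (x e : Point r t) (b : Fin m → Point r t) (d : Fin (suc (suc m)) → Fin r) →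
                        d (fs fz) ≡ 0F → ∀ i →
                        lookup (lincomb d (x Vecᶠ.∷ (e Vecᶠ.∷ b))) i ≡
                        (d fz *F lookup x i) +F lookup (lincomb (d ∘ fs ∘ fs) b) i
  lookup-lincomb-skip x e b d d₁≡0 i = begin
    lookup ((d fz ·P x) +P ((d (fs fz) ·P e) +P lincomb (d ∘ fs ∘ fs) b)) i
      ≡⟨ lookup-+P (d fz ·P x) _ i ⟩
    lookup (d fz ·P x) i +F lookup ((d (fs fz) ·P e) +P lincomb (d ∘ fs ∘ fs) b) i
      ≡⟨ cong₂ _+F_ (lookup-·P (d fz) x i) (lookup-+P (d (fs fz) ·P e) (lincomb (d ∘ fs ∘ fs) b) i) ⟩
    (d fz *F lookup x i) +F (lookup (d (fs fz) ·P e) i +F lookup (lincomb (d ∘ fs ∘ fs) b) i)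
      ≡⟨ cong (λ y → (d fz *F lookup x i) +F (y +F lookup (lincomb (d ∘ fs ∘ fs) b) i)) e-term ⟩
    (d fz *F lookup x i) +F (0F +F lookup (lincomb (d ∘ fs ∘ fs) b) i)
      ≡⟨ cong ((d fz *F lookup x i) +F_) (𝔽.+-identityˡ (lookup (lincomb (d ∘ fs ∘ fs) b) i)) ⟩
    (d fz *F lookup x i) +F lookup (lincomb (d ∘ fs ∘ fs) b) i ∎
    where
    open ≡-Reasoning
    e-term : lookup (d (fs fz) ·P e) i ≡ 0F
    e-term = trans (lookup-·P (d (fs fz)) e i) (trans (cong (_*F lookup e i) d₁≡0) (𝔽.zeroˡ (lookup e i)))

  -- Among x, a unit vector e with a·e ≠ 0 and the basis b there is a nontrivial
  -- relation; pairing it with a kills the coefficient of e, and independence of b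
  -- makes the coefficient of x invertible.
  kernel⊆span : ∀ {m} {a : Point r (suc m)} {b : Fin m → Point r (suc m)} → LinIndep b → a ≢ 0P →
                (∀ k → dot a (b k) ≡ 0F) → ∀ x → dot a x ≡ 0F → ∃ λ e → lincomb e b ≡ x
  kernel⊆span {m} {a} {b} b-indep a≢0 a⊥b x a⊥x = through-unit (≢0P⇒∃lookup≢0F a a≢0)
    where
    through-unit : (∃ λ j → lookup a j ≢ 0F) → ∃ λ e → lincomb e b ≡ x
    through-unit (j , aj≢0) = from-relation (linearDependence (ℕ.n<1+n (suc m)) (x Vecᶠ.∷ (unit j Vecᶠ.∷ b)))
      where
      from-relation : (∃ λ d → (∃ λ l → d l ≢ 0F) × lincomb d (x Vecᶠ.∷ (unit j Vecᶠ.∷ b)) ≡ 0P) →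
                      ∃ λ e → lincomb e b ≡ x
      from-relation (d , (l , dl≢0) , d-kills) =
        (λ k → -F (d₀⁻¹ *F d (fs (fs k)))) , lincomb-solve (d fz) d₀⁻¹ x (d ∘ fs ∘ fs) b d₀⁻¹d₀≡1 relation
        where
        d₁≡0 : d (fs fz) ≡ 0F
        d₁≡0 = relation-pairing a x (unit j) b d a⊥x a⊥b (aj≢0 ∘ trans (sym (dot-unitʳ a j))) d-kills

        relation : ∀ i → (d fz *F lookup x i) +F lookup (lincomb (d ∘ fs ∘ fs) b) i ≡ 0F
        relation i = trans (sym (lookup-lincomb-skip x (unit j) b d d₁≡0 i))
                           (trans (cong (λ v → lookup v i) d-kills) (lookup-0P i))

        d₀≢0 : d fz ≢ 0F
        d₀≢0 d₀≡0 = dl≢0 (all-zero l)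
          where
          rest-kills : lincomb (d ∘ fs ∘ fs) b ≡ 0P
          rest-kills = lookup-ext λ i → trans (sym (𝔽.+-identityˡ (lookup (lincomb (d ∘ fs ∘ fs) b) i)))
            (trans (cong (_+F lookup (lincomb (d ∘ fs ∘ fs) b) i)
                         (sym (trans (cong (_*F lookup x i) d₀≡0) (𝔽.zeroˡ (lookup x i)))))
                   (trans (relation i) (sym (lookup-0P i))))
          all-zero : ∀ l → d l ≡ 0F
          all-zero fz          = d₀≡0
          all-zero (fs fz)     = d₁≡0
          all-zero (fs (fs k)) = b-indep (d ∘ fs ∘ fs) rest-kills k

        d₀⁻¹ : Fin r
        d₀⁻¹ = proj₁ (*F-inverse (d fz) d₀≢0)
        d₀⁻¹d₀≡1 : d₀⁻¹ *F d fz ≡ 1F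
        d₀⁻¹d₀≡1 = trans (*F-comm d₀⁻¹ (d fz)) (proj₂ (*F-inverse (d fz) d₀≢0))

  hyperplane⇒kernel : ∀ {m} {S : PSet r (suc m)} → IsSubspaceOfDim S m →
                      ∃ λ a → a ≢ 0P × (∀ x → S x ≡ isZero (dot a x))
  hyperplane⇒kernel {m} {S} (b , b-indep , b-spans) = from-normal (orthogonal-vector b)
    where
    from-normal : (∃ λ a → a ≢ 0P × (∀ k → dot a (b k) ≡ 0F)) → ∃ λ a → a ≢ 0P × (∀ x → S x ≡ isZero (dot a x))
    from-normal (a , a≢0 , a⊥b) = a , a≢0 , λ x → S≡kernel x (S x) refl
      where
      S≡kernel : ∀ x s → S x ≡ s → S x ≡ isZero (dot a x)
      S≡kernel x true  Sx = trans Sx (sym (dec-true (dot a x ≟F 0F) (span⊆kernel {a = a} {b} a⊥b (proj₁ (b-spans x) Sx))))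
      S≡kernel x false Sx = trans Sx (sym (dec-false (dot a x ≟F 0F) λ a⊥x →
                              case trans (sym Sx) (proj₂ (b-spans x) (kernel⊆span {a = a} {b} b-indep a≢0 a⊥b x a⊥x)) of λ ()))

module Counting (r : ℕ) {{_ : NonZero r}} (r-prime : Prime r) where
  open Data.Nat using (_+_; _*_)
  open LinearAlgebra r r-prime public

  count-*F≡ : ∀ {c} → c ≢ 0F → ∀ w → ∑[ x < r ] 𝟙 (does (c *F x ≟F w)) ≡ 1
  count-*F≡ {c} c≢0 w = trans (sum-pick ℕ.+-0-monoid _ x₀ off-x₀) (cong 𝟙 (dec-true (c *F x₀ ≟F w) cx₀≡w))
    where
    c⁻¹ = proj₁ (*F-inverse c c≢0)
    x₀ = c⁻¹ *F w
    cx₀≡w : c *F x₀ ≡ w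
    cx₀≡w = trans (sym (*F-assoc c c⁻¹ w)) (trans (cong (_*F w) (proj₂ (*F-inverse c c≢0))) (*F-identityˡ w))
    off-x₀ : ∀ x → x ≢ x₀ → 𝟙 (does (c *F x ≟F w)) ≡ 0
    off-x₀ x x≢x₀ = cong 𝟙 (dec-false (c *F x ≟F w) (λ cx≡w → x≢x₀ (*F-cancelˡ c≢0 (trans cx≡w (sym cx₀≡w)))))

  count-≢0F : ∑[ l < r ] 𝟙 (not (isZero l)) ≡ r ∸ 1
  count-≢0F = trans (sum-𝟙-not isZero) (cong (r ∸_) count-0F)
    where
    count-0F : ∑[ l < r ] 𝟙 (isZero l) ≡ 1
    count-0F = trans (sum-pick ℕ.+-0-monoid _ 0F (λ l l≢0 → cong 𝟙 (dec-false (l ≟F 0F) l≢0)))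
                     (cong 𝟙 (dec-true (0F ≟F 0F) refl))

  +F-shift : ∀ α y w → does (α +F y ≟F w) ≡ does (y ≟F w +F (-F α))
  +F-shift α y w = does-⇔ (mk⇔ to from) (α +F y ≟F w) (y ≟F w +F (-F α))
    where
    open ≡-Reasoning
    to : α +F y ≡ w → y ≡ w +F (-F α)
    to α+y≡w = begin
      y                        ≡⟨ 𝔽.+-identityʳ y ⟨
      y +F 0F                  ≡⟨ cong (y +F_) (𝔽.-‿inverseʳ α) ⟨
      y +F (α +F (-F α))       ≡⟨ +F-assoc y α (-F α) ⟨
      (y +F α) +F (-F α)       ≡⟨ cong (_+F (-F α)) (trans (+F-comm y α) α+y≡w) ⟩
      w +F (-F α)              ∎
    from : y ≡ w +F (-F α) → α +F y ≡ w
    from refl = begin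
      α +F (w +F (-F α))       ≡⟨ +F-comm α _ ⟩
      (w +F (-F α)) +F α       ≡⟨ +F-assoc w (-F α) α ⟩
      w +F ((-F α) +F α)       ≡⟨ cong (w +F_) (-F-inverseˡ α) ⟩
      w +F 0F                  ≡⟨ 𝔽.+-identityʳ w ⟩
      w                        ∎

  count-dot≡ : ∀ n (c : Point r (suc n)) → c ≢ 0P → ∀ u → ∑ᵥ (λ x → 𝟙 (does (dot c x ≟F u))) ≡ r ^ n
  count-dot≡ zero (c₀ ∷ []) c≢0 u = begin
    ∑ᵥ (λ x → 𝟙 (does (dot (c₀ ∷ []) x ≟F u)))
      ≡⟨ ∑ᵥ-∷ (λ x → 𝟙 (does (dot (c₀ ∷ []) x ≟F u))) ⟩
    ∑[ a < r ] ∑ᵥ (λ v → 𝟙 (does (dot (c₀ ∷ []) (a ∷ v) ≟F u)))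
      ≡⟨ sum-cong-≗ (λ a → trans (∑ᵥ-[] (λ v → 𝟙 (does (dot (c₀ ∷ []) (a ∷ v) ≟F u))))
                                 (cong (λ y → 𝟙 (does (y ≟F u))) (𝔽.+-identityʳ (c₀ *F a)))) ⟩
    ∑[ a < r ] 𝟙 (does (c₀ *F a ≟F u))
      ≡⟨ count-*F≡ (c≢0 ∘ cong (_∷ [])) u ⟩
    1 ∎
    where open ≡-Reasoning
  count-dot≡ (suc n) (c₀ ∷ c′) c≢0 u with c′ ≟ᵥ 0P
  ... | yes c′≡0 = begin
    ∑ᵥ (λ x → 𝟙 (does (dot (c₀ ∷ c′) x ≟F u)))
      ≡⟨ ∑ᵥ-∷ (λ x → 𝟙 (does (dot (c₀ ∷ c′) x ≟F u))) ⟩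
    ∑[ a < r ] ∑ᵥ (λ v → 𝟙 (does ((c₀ *F a) +F dot c′ v ≟F u)))
      ≡⟨ sum-cong-≗ (λ a → trans (∑ᵥ-cong (λ v → cong (λ y → 𝟙 (does (y ≟F u))) (c′-vanishes a v)))
                                 (sum-const (r ^ suc n) (𝟙 (does (c₀ *F a ≟F u))))) ⟩
    ∑[ a < r ] (r ^ suc n * 𝟙 (does (c₀ *F a ≟F u)))
      ≡⟨ *-distribˡ-sum (r ^ suc n) (λ a → 𝟙 (does (c₀ *F a ≟F u))) ⟨
    r ^ suc n * ∑[ a < r ] 𝟙 (does (c₀ *F a ≟F u))
      ≡⟨ cong (r ^ suc n *_) (count-*F≡ (c≢0 ∘ flip (cong₂ _∷_) c′≡0) u) ⟩
    r ^ suc n * 1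
      ≡⟨ ℕ.*-identityʳ (r ^ suc n) ⟩
    r ^ suc n ∎
    where
    open ≡-Reasoning
    c′-vanishes : ∀ a v → (c₀ *F a) +F dot c′ v ≡ c₀ *F a
    c′-vanishes a v = trans (cong (λ w → (c₀ *F a) +F dot w v) c′≡0)
                            (trans (cong ((c₀ *F a) +F_) (dot-0Pˡ v)) (𝔽.+-identityʳ (c₀ *F a)))
  ... | no c′≢0 = begin
    ∑ᵥ (λ x → 𝟙 (does (dot (c₀ ∷ c′) x ≟F u)))
      ≡⟨ ∑ᵥ-∷ (λ x → 𝟙 (does (dot (c₀ ∷ c′) x ≟F u))) ⟩
    ∑[ a < r ] ∑ᵥ (λ v → 𝟙 (does ((c₀ *F a) +F dot c′ v ≟F u)))
      ≡⟨ sum-cong-≗ (λ a → ∑ᵥ-cong (λ v → cong 𝟙 (+F-shift (c₀ *F a) (dot c′ v) u))) ⟩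
    ∑[ a < r ] ∑ᵥ (λ v → 𝟙 (does (dot c′ v ≟F u +F (-F (c₀ *F a)))))
      ≡⟨ sum-cong-≗ (λ a → count-dot≡ n c′ c′≢0 (u +F (-F (c₀ *F a)))) ⟩
    ∑[ a < r ] (r ^ n)
      ≡⟨ sum-const r (r ^ n) ⟩
    r ^ suc n ∎
    where open ≡-Reasoning

  count-pencil : ∀ α β → ∑[ l < r ] 𝟙 (isZero (α +F (l *F β))) ≡ 𝟙 (not (isZero β)) + r * 𝟙 (isZero β ∧ isZero α)
  count-pencil α β with β ≟F 0F
  ... | yes refl = begin
    ∑[ l < r ] 𝟙 (isZero (α +F (l *F 0F)))
      ≡⟨ sum-cong-≗ (λ l → cong (𝟙 ∘ isZero) (trans (cong (α +F_) (𝔽.zeroʳ l)) (𝔽.+-identityʳ α))) ⟩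
    ∑[ l < r ] 𝟙 (isZero α)
      ≡⟨ sum-const r (𝟙 (isZero α)) ⟩
    r * 𝟙 (isZero α) ∎
    where open ≡-Reasoning
  ... | no β≢0 = begin
    ∑[ l < r ] 𝟙 (isZero (α +F (l *F β)))
      ≡⟨ sum-cong-≗ (λ l → cong 𝟙 (trans (+F-shift α (l *F β) 0F) (cong (λ y → does (y ≟F 0F +F (-F α))) (*F-comm l β)))) ⟩
    ∑[ l < r ] 𝟙 (does (β *F l ≟F 0F +F (-F α)))
      ≡⟨ count-*F≡ β≢0 (0F +F (-F α)) ⟩
    1
      ≡⟨ cong (1 +_) (ℕ.*-zeroʳ r) ⟨
    1 + r * 0 ∎
    where open ≡-Reasoning

  -- Every member of the pencil a + l b is a nonzero functional; counting the
  -- pairs (l, x) with (a + l b)·x = 0 in two ways isolates the common kernel.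
  count-common-kernel : ∀ n (a b : Point r (suc (suc n))) → b ≢ 0P → (∀ l → a +P (l ·P b) ≢ 0P) →
                        ∑ᵥ (λ x → 𝟙 (isZero (dot b x) ∧ isZero (dot a x))) ≡ r ^ n
  count-common-kernel n a b b≢0 pencil≢0 =
    ℕ.*-cancelˡ-≡ common (r ^ n) r (ℕ.+-cancelˡ-≡ off-kernel (r * common) (r * r ^ n) (begin
    off-kernel + r * common                   ≡⟨ pencil-by-points ⟨
    ∑[ l < r ] ∑ᵥ (pencil-kernel l)           ≡⟨ sum-cong-≗ (λ l → count-dot≡ (suc n) (a +P (l ·P b)) (pencil≢0 l) 0F) ⟩
    ∑[ l < r ] (r ^ suc n)                    ≡⟨ sum-const r (r ^ suc n) ⟩
    r ^ suc (suc n)                           ≡⟨ trans (sum-const (r ^ suc (suc n)) 1) (ℕ.*-identityʳ (r ^ suc (suc n))) ⟨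
    ∑ᵥ {suc (suc n)} (λ _ → 1)                ≡⟨ ∑ᵥ-cong (λ x → 𝟙-not (isZero (dot b x))) ⟨
    ∑ᵥ (λ x → 𝟙 (not (isZero (dot b x))) + 𝟙 (isZero (dot b x)))
                                              ≡⟨ ∑ᵥ-+ (λ x → 𝟙 (not (isZero (dot b x)))) (λ x → 𝟙 (isZero (dot b x))) ⟩
    off-kernel + ∑ᵥ (λ x → 𝟙 (isZero (dot b x)))
                                              ≡⟨ cong (off-kernel +_) (count-dot≡ (suc n) b b≢0 0F) ⟩
    off-kernel + r * r ^ n                    ∎))
    where
    open ≡-Reasoning
    common off-kernel : ℕ
    common     = ∑ᵥ (λ x → 𝟙 (isZero (dot b x) ∧ isZero (dot a x)))
    off-kernel = ∑ᵥ (λ x → 𝟙 (not (isZero (dot b x))))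
    pencil-kernel : Fin r → Point r (suc (suc n)) → ℕ
    pencil-kernel l x = 𝟙 (isZero (dot (a +P (l ·P b)) x))
    pencil-by-points : ∑[ l < r ] ∑ᵥ (pencil-kernel l) ≡ off-kernel + r * common
    pencil-by-points = begin
      ∑[ l < r ] ∑ᵥ (pencil-kernel l)
        ≡⟨ ∑-∑ᵥ-comm pencil-kernel ⟩
      ∑ᵥ (λ x → ∑[ l < r ] pencil-kernel l x)
        ≡⟨ ∑ᵥ-cong (λ x → sum-cong-≗ (λ l → cong (𝟙 ∘ isZero)
             (trans (dot-+Pˡ a (l ·P b) x) (cong (dot a x +F_) (dot-·Pˡ l b x))))) ⟩
      ∑ᵥ (λ x → ∑[ l < r ] 𝟙 (isZero (dot a x +F (l *F dot b x))))
        ≡⟨ ∑ᵥ-cong (λ x → count-pencil (dot a x) (dot b x)) ⟩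
      ∑ᵥ (λ x → 𝟙 (not (isZero (dot b x))) + r * 𝟙 (isZero (dot b x) ∧ isZero (dot a x)))
        ≡⟨ ∑ᵥ-+ (λ x → 𝟙 (not (isZero (dot b x)))) (λ x → r * 𝟙 (isZero (dot b x) ∧ isZero (dot a x))) ⟩
      off-kernel + ∑ᵥ (λ x → r * 𝟙 (isZero (dot b x) ∧ isZero (dot a x)))
        ≡⟨ cong (off-kernel +_) (∑ᵥ-*ˡ r (λ x → 𝟙 (isZero (dot b x) ∧ isZero (dot a x)))) ⟩
      off-kernel + r * common ∎

module Hyperplanes (r : ℕ) {{_ : NonZero r}} (r-prime : Prime r) {t₂ G : ℕ}
                   (V : Fin G → PSet r (suc (suc t₂))) (V-enum : IsHyperplaneEnum V) where
  open Data.Nat using (_+_; _*_)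
  open Counting r r-prime public

  private
    t : ℕ
    t = suc (suc t₂)

  normal : Fin G → Point r t
  normal i = proj₁ (hyperplane⇒kernel (proj₁ V-enum i))

  normal≢0P : ∀ i → normal i ≢ 0P
  normal≢0P i = proj₁ (proj₂ (hyperplane⇒kernel (proj₁ V-enum i)))

  V≡kernel : ∀ i x → V i x ≡ isZero (dot (normal i) x)
  V≡kernel i = proj₂ (proj₂ (hyperplane⇒kernel (proj₁ V-enum i)))

  same-kernel⇒≡ : ∀ i k → (∀ x → isZero (dot (normal i) x) ≡ isZero (dot (normal k) x)) → i ≡ k
  same-kernel⇒≡ i k same = proj₁ (proj₂ V-enum) i k (λ x → trans (V≡kernel i x) (trans (same x) (sym (V≡kernel k x))))

  isZero-dot-·P : ∀ {n l} → l ≢ 0F → ∀ (v x : Point r n) → isZero (dot (l ·P v) x) ≡ isZero (dot v x)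
  isZero-dot-·P {l = l} l≢0 v x = trans (cong isZero (dot-·Pˡ l v x)) (isZero-*F l≢0 (dot v x))

  scaled-normal-injective : ∀ {i k l l′} → l ≢ 0F → l′ ≢ 0F → l ·P normal i ≡ l′ ·P normal k → i ≡ k × l ≡ l′
  scaled-normal-injective {i} {k} {l} {l′} l≢0 l′≢0 eq = i≡k , ·P-cancelʳ (normal≢0P i) eq′
    where
    i≡k : i ≡ k
    i≡k = same-kernel⇒≡ i k (λ x → trans (sym (isZero-dot-·P l≢0 (normal i) x))
            (trans (cong (λ v → isZero (dot v x)) eq) (isZero-dot-·P l′≢0 (normal k) x)))
    eq′ : l ·P normal i ≡ l′ ·P normal i
    eq′ = subst (λ k → l ·P normal i ≡ l′ ·P normal k) (sym i≡k) eq

  count-V : ∀ i → ∑ᵥ (𝟙 ∘ V i) ≡ r ^ suc t₂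
  count-V i = trans (∑ᵥ-cong (cong 𝟙 ∘ V≡kernel i)) (count-dot≡ (suc t₂) (normal i) (normal≢0P i) 0F)

  count-V∩V : ∀ {i k} → i ≢ k → ∑ᵥ (λ x → 𝟙 (V i x ∧ V k x)) ≡ r ^ t₂
  count-V∩V {i} {k} i≢k =
    trans (∑ᵥ-cong (λ x → cong₂ (λ p q → 𝟙 (p ∧ q)) (V≡kernel i x) (V≡kernel k x)))
          (count-common-kernel t₂ (normal k) (normal i) (normal≢0P i) pencil≢0)
    where
    pencil≢0 : ∀ l → normal k +P (l ·P normal i) ≢ 0P
    pencil≢0 l pencil≡0 with l ≟F 0F
    ... | yes refl = normal≢0P k (lookup-ext λ j → begin
      lookup (normal k) j                                  ≡⟨ 𝔽.+-identityʳ (lookup (normal k) j) ⟨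
      lookup (normal k) j +F 0F                             ≡⟨ cong (lookup (normal k) j +F_) (𝔽.zeroˡ (lookup (normal i) j)) ⟨
      lookup (normal k) j +F (0F *F lookup (normal i) j)    ≡⟨ cong (lookup (normal k) j +F_) (lookup-·P 0F (normal i) j) ⟨
      lookup (normal k) j +F lookup (0F ·P normal i) j      ≡⟨ lookup-+P (normal k) (0F ·P normal i) j ⟨
      lookup (normal k +P (0F ·P normal i)) j               ≡⟨ cong (λ v → lookup v j) pencil≡0 ⟩
      lookup 0P j                                           ∎)
      where open ≡-Reasoning
    ... | no l≢0 = i≢k (same-kernel⇒≡ i k λ x → sym (begin
      isZero (dot (normal k) x)                       ≡⟨ cong isZero (𝔽-Props.+-inverseˡ-unique _ _ (relation x)) ⟩
      isZero (-F (l *F dot (normal i) x))             ≡⟨ cong isZero (𝔽-Props.-‿distribˡ-* l (dot (normal i) x)) ⟩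
      isZero ((-F l) *F dot (normal i) x)             ≡⟨ isZero-*F (-F-≢0 l≢0) (dot (normal i) x) ⟩
      isZero (dot (normal i) x)                       ∎))
      where
      open ≡-Reasoning
      relation : ∀ x → dot (normal k) x +F (l *F dot (normal i) x) ≡ 0F
      relation x = begin
        dot (normal k) x +F (l *F dot (normal i) x)   ≡⟨ cong (dot (normal k) x +F_) (dot-·Pˡ l (normal i) x) ⟨
        dot (normal k) x +F dot (l ·P normal i) x     ≡⟨ dot-+Pˡ (normal k) (l ·P normal i) x ⟨
        dot (normal k +P (l ·P normal i)) x           ≡⟨ cong (λ v → dot v x) pencil≡0 ⟩
        dot 0P x                                      ≡⟨ dot-0Pˡ x ⟩
        0F                                            ∎

  scaledNormal : Point r t → Fin G → Fin r → Bool
  scaledNormal a i l = not (isZero l) ∧ does (a ≟ᵥ l ·P normal i)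

  scaledNormal-true : ∀ a i l → 0 < 𝟙 (scaledNormal a i l) → l ≢ 0F × a ≡ l ·P normal i
  scaledNormal-true a i l pos with l ≟F 0F | a ≟ᵥ l ·P normal i
  ... | no l≢0 | yes a≡lnᵢ = l≢0 , a≡lnᵢ

  isOrigin : Point r t → Bool
  isOrigin a = does (a ≟ᵥ 0P)

  isOrigin-0P : isOrigin 0P ≡ true
  isOrigin-0P = dec-true (0P {r} {t} ≟ᵥ 0P) refl

  isOrigin-≢0P : ∀ {a} → a ≢ 0P → isOrigin a ≡ false
  isOrigin-≢0P {a} = dec-false (a ≟ᵥ 0P)

  multiplicity : Point r t → ℕ
  multiplicity a = ∑[ i < G ] ∑[ l < r ] 𝟙 (scaledNormal a i l)

  multiplicity-≤ : ∀ a → multiplicity a ≤ 𝟙 (not (isOrigin a))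
  multiplicity-≤ a with a ≟ᵥ 0P
  ... | yes refl = ℕ.≤-reflexive (sum-zero (λ i → sum-zero (λ l → ℕ.n≤0⇒n≡0 (ℕ.≮⇒≥ (λ pos →
                     let l≢0 , 0≡lnᵢ = scaledNormal-true 0P i l pos in ·P-≢0P l≢0 (normal≢0P i) (sym 0≡lnᵢ))))))
  ... | no _ = sum-≤1 (λ i → ∑[ l < r ] 𝟙 (scaledNormal a i l)) inner-≤1 same-i
    where
    inner-≤1 : ∀ i → ∑[ l < r ] 𝟙 (scaledNormal a i l) ≤ 1
    inner-≤1 i = sum-≤1 (λ l → 𝟙 (scaledNormal a i l)) (𝟙≤1 ∘ scaledNormal a i) λ l l′ p q →
      let l≢0  , a≡lnᵢ  = scaledNormal-true a i l p
          l′≢0 , a≡l′nᵢ = scaledNormal-true a i l′ q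
      in proj₂ (scaled-normal-injective l≢0 l′≢0 (trans (sym a≡lnᵢ) a≡l′nᵢ))
    same-i : ∀ i k → 0 < ∑[ l < r ] 𝟙 (scaledNormal a i l) → 0 < ∑[ l < r ] 𝟙 (scaledNormal a k l) → i ≡ k
    same-i i k p q =
      let l  , pl  = sum>0⇒∃ (λ l → 𝟙 (scaledNormal a i l)) p
          l′ , ql′ = sum>0⇒∃ (λ l → 𝟙 (scaledNormal a k l)) q
          l≢0  , a≡lnᵢ  = scaledNormal-true a i l pl
          l′≢0 , a≡l′nₖ = scaledNormal-true a k l′ ql′
      in proj₁ (scaled-normal-injective l≢0 l′≢0 (trans (sym a≡lnᵢ) a≡l′nₖ))

  ∑-multiplicity-* : ∀ (g : Point r t → ℕ) →
                     ∑ᵥ (λ a → multiplicity a * g a) ≡ ∑[ i < G ] ∑[ l < r ] (𝟙 (not (isZero l)) * g (l ·P normal i))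
  ∑-multiplicity-* g = begin
    ∑ᵥ (λ a → multiplicity a * g a)
      ≡⟨ ∑ᵥ-cong (λ a → trans (*-distribʳ-sum (g a) (λ i → ∑[ l < r ] 𝟙 (scaledNormal a i l)))
                                  (sum-cong-≗ (λ i → *-distribʳ-sum (g a) (λ l → 𝟙 (scaledNormal a i l))))) ⟩
    ∑ᵥ (λ a → ∑[ i < G ] ∑[ l < r ] (𝟙 (scaledNormal a i l) * g a))
      ≡⟨ ∑-∑ᵥ-comm (λ i a → ∑[ l < r ] (𝟙 (scaledNormal a i l) * g a)) ⟨
    ∑[ i < G ] ∑ᵥ (λ a → ∑[ l < r ] (𝟙 (scaledNormal a i l) * g a))
      ≡⟨ sum-cong-≗ (λ i → ∑-∑ᵥ-comm (λ l a → 𝟙 (scaledNormal a i l) * g a)) ⟨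
    ∑[ i < G ] ∑[ l < r ] ∑ᵥ (λ a → 𝟙 (scaledNormal a i l) * g a)
      ≡⟨ sum-cong-≗ (λ i → sum-cong-≗ (λ l →
           trans (∑ᵥ-pick (λ a → 𝟙 (scaledNormal a i l) * g a) (l ·P normal i) (off i l)) (at i l))) ⟩
    ∑[ i < G ] ∑[ l < r ] (𝟙 (not (isZero l)) * g (l ·P normal i)) ∎
    where
    open ≡-Reasoning
    off : ∀ i l a → a ≢ l ·P normal i → 𝟙 (scaledNormal a i l) * g a ≡ 0
    off i l a a≢lnᵢ = trans (cong (λ b → 𝟙 (not (isZero l) ∧ b) * g a) (dec-false (a ≟ᵥ l ·P normal i) a≢lnᵢ))
                            (cong (λ b → 𝟙 b * g a) (∧-zeroʳ (not (isZero l))))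
    at : ∀ i l → 𝟙 (scaledNormal (l ·P normal i) i l) * g (l ·P normal i) ≡ 𝟙 (not (isZero l)) * g (l ·P normal i)
    at i l = trans (cong (λ b → 𝟙 (not (isZero l) ∧ b) * g (l ·P normal i)) (dec-true (l ·P normal i ≟ᵥ l ·P normal i) refl))
                   (cong (λ b → 𝟙 b * g (l ·P normal i)) (∧-identityʳ (not (isZero l))))

  -- With exactly (r^t − 1)/(r − 1) hyperplanes, the injective map (i , l) ↦ l · normal i
  -- from pairs with l ≠ 0 to nonzero vectors is a bijection.
  multiplicity≡ : G * (r ∸ 1) ≡ r ^ t ∸ 1 → ∀ a → multiplicity a ≡ 𝟙 (not (isOrigin a))
  multiplicity≡ G-count a = trans (cong multiplicity (sym (decode-encode a)))
    (trans (sum-mono-≤-≡⇒≗ (multiplicity-≤ ∘ decode t) total (encode a))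
           (cong (λ b → 𝟙 (not (isOrigin b))) (decode-encode a)))
    where
    total : ∑ᵥ multiplicity ≡ ∑ᵥ (λ a → 𝟙 (not (isOrigin a)))
    total = begin
      ∑ᵥ multiplicity                                  ≡⟨ ∑ᵥ-cong (λ a → ℕ.*-identityʳ (multiplicity a)) ⟨
      ∑ᵥ (λ a → multiplicity a * 1)                    ≡⟨ ∑-multiplicity-* (λ _ → 1) ⟩
      ∑[ i < G ] ∑[ l < r ] (𝟙 (not (isZero l)) * 1)   ≡⟨ sum-cong-≗ {G} (λ i →
                                                            trans (sum-cong-≗ (ℕ.*-identityʳ ∘ 𝟙 ∘ not ∘ isZero)) count-≢0F) ⟩
      ∑[ i < G ] (r ∸ 1)                               ≡⟨ sum-const G (r ∸ 1) ⟩
      G * (r ∸ 1)                                      ≡⟨ G-count ⟩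
      r ^ t ∸ 1                                        ≡⟨ cong (r ^ t ∸_) count-0P ⟨
      r ^ t ∸ ∑ᵥ (λ a → 𝟙 (isOrigin a))                ≡⟨ sum-𝟙-not (λ k → isOrigin (decode t k)) ⟨
      ∑ᵥ (λ a → 𝟙 (not (isOrigin a)))                  ∎
      where
      open ≡-Reasoning
      count-0P : ∑ᵥ (λ a → 𝟙 (isOrigin a)) ≡ 1
      count-0P = trans (∑ᵥ-pick (λ a → 𝟙 (isOrigin a)) 0P (λ a a≢0 → cong 𝟙 (isOrigin-≢0P a≢0))) (cong 𝟙 isOrigin-0P)

  count-V-through : G * (r ∸ 1) ≡ r ^ t ∸ 1 → ∀ {x} → x ≢ 0P → (∑[ i < G ] 𝟙 (V i x)) * (r ∸ 1) ≡ r ^ suc t₂ ∸ 1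
  count-V-through G-count {x} x≢0 = begin
    (∑[ i < G ] 𝟙 (V i x)) * (r ∸ 1)
      ≡⟨ *-distribʳ-sum (r ∸ 1) (λ i → 𝟙 (V i x)) ⟩
    ∑[ i < G ] (𝟙 (V i x) * (r ∸ 1))
      ≡⟨ sum-cong-≗ (λ i → trans (cong (𝟙 (V i x) *_) (sym count-≢0F))
                       (trans (*-distribˡ-sum (𝟙 (V i x)) (λ l → 𝟙 (not (isZero l))))
                              (sum-cong-≗ (λ l → ℕ.*-comm (𝟙 (V i x)) (𝟙 (not (isZero l))))))) ⟩
    ∑[ i < G ] ∑[ l < r ] (𝟙 (not (isZero l)) * 𝟙 (V i x))
      ≡⟨ sum-cong-≗ (λ i → sum-cong-≗ (through-scaled i)) ⟩
    ∑[ i < G ] ∑[ l < r ] (𝟙 (not (isZero l)) * 𝟙 (isZero (dot (l ·P normal i) x)))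
      ≡⟨ ∑-multiplicity-* (λ a → 𝟙 (isZero (dot a x))) ⟨
    ∑ᵥ (λ a → multiplicity a * 𝟙 (isZero (dot a x)))
      ≡⟨ ∑ᵥ-cong (λ a → cong (_* 𝟙 (isZero (dot a x))) (multiplicity≡ G-count a)) ⟩
    ∑ᵥ (λ a → 𝟙 (not (isOrigin a)) * 𝟙 (isZero (dot a x)))
      ≡⟨ sum-𝟙-not-* (λ k → isOrigin (decode t k)) (λ k → 𝟙 (isZero (dot (decode t k) x))) ⟩
    ∑ᵥ (λ a → 𝟙 (isZero (dot a x))) ∸ ∑ᵥ (λ a → 𝟙 (isOrigin a) * 𝟙 (isZero (dot a x)))
      ≡⟨ cong₂ _∸_ kernel-size zero-in-kernel ⟩
    r ^ suc t₂ ∸ 1 ∎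
    where
    open ≡-Reasoning
    through-scaled : ∀ i l → 𝟙 (not (isZero l)) * 𝟙 (V i x) ≡ 𝟙 (not (isZero l)) * 𝟙 (isZero (dot (l ·P normal i) x))
    through-scaled i l with l ≟F 0F
    ... | yes _  = refl
    ... | no l≢0 = cong (λ b → 1 * 𝟙 b) (trans (V≡kernel i x) (sym (isZero-dot-·P l≢0 (normal i) x)))
    kernel-size : ∑ᵥ (λ a → 𝟙 (isZero (dot a x))) ≡ r ^ suc t₂
    kernel-size = trans (∑ᵥ-cong (λ a → cong (𝟙 ∘ isZero) (dot-comm a x))) (count-dot≡ (suc t₂) x x≢0 0F)
    zero-in-kernel : ∑ᵥ (λ a → 𝟙 (isOrigin a) * 𝟙 (isZero (dot a x))) ≡ 1
    zero-in-kernel = begin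
      ∑ᵥ (λ a → 𝟙 (isOrigin a) * 𝟙 (isZero (dot a x)))
        ≡⟨ ∑ᵥ-pick (λ a → 𝟙 (isOrigin a) * 𝟙 (isZero (dot a x))) 0P
                   (λ a a≢0 → cong (λ b → 𝟙 b * 𝟙 (isZero (dot a x))) (isOrigin-≢0P a≢0)) ⟩
      𝟙 (isOrigin 0P) * 𝟙 (isZero (dot 0P x))
        ≡⟨ cong₂ (λ b c → 𝟙 b * 𝟙 c) isOrigin-0P (dec-true (dot 0P x ≟F 0F) (dot-0Pˡ x)) ⟩
      1 ∎

module GeometricSum where
  open Data.Nat using (_+_; _*_)

  geometric : ℕ → ℕ → ℕ
  geometric q zero    = 0
  geometric q (suc n) = 1 + q * geometric q n

  geometric-*-pred : ∀ m n → geometric (suc m) n * m + 1 ≡ suc m ^ n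
  geometric-*-pred m zero    = refl
  geometric-*-pred m (suc n) = trans (expand m (geometric (suc m) n)) (cong (suc m *_) (geometric-*-pred m n))
    where
    open +-*-Solver
    expand : ∀ m g → (1 + suc m * g) * m + 1 ≡ suc m * (g * m + 1)
    expand = solve 2 (λ m g → (con 1 :+ (con 1 :+ m) :* g) :* m :+ con 1 := (con 1 :+ m) :* (g :* m :+ con 1)) refl

  gauss≡geometric : ∀ k n → gauss (suc (suc k)) n ≡ geometric (suc (suc k)) n
  gauss≡geometric k n = begin
    (suc (suc k) ^ n ∸ 1) / suc k
      ≡⟨ cong (λ m → (m ∸ 1) / suc k) (geometric-*-pred (suc k) n) ⟨
    (geometric (suc (suc k)) n * suc k + 1 ∸ 1) / suc k
      ≡⟨ cong (_/ suc k) (ℕ.m+n∸n≡m (geometric (suc (suc k)) n * suc k) 1) ⟩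
    geometric (suc (suc k)) n * suc k / suc k
      ≡⟨ m*n/n≡m (geometric (suc (suc k)) n) (suc k) ⟩
    geometric (suc (suc k)) n ∎
    where open ≡-Reasoning

  gauss-*-pred : ∀ k n → gauss (suc (suc k)) n * suc k ≡ suc (suc k) ^ n ∸ 1
  gauss-*-pred k n = begin
    gauss (suc (suc k)) n * suc k                  ≡⟨ cong (_* suc k) (gauss≡geometric k n) ⟩
    geometric (suc (suc k)) n * suc k              ≡⟨ ℕ.m+n∸n≡m (geometric (suc (suc k)) n * suc k) 1 ⟨
    geometric (suc (suc k)) n * suc k + 1 ∸ 1      ≡⟨ cong (_∸ 1) (geometric-*-pred (suc k) n) ⟩
    suc (suc k) ^ n ∸ 1                            ∎
    where open ≡-Reasoning

module MatrixEntries {c ℓ} (R : CommutativeRing c ℓ) where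
  open CommutativeRing R renaming (refl to ≈-refl; sym to ≈-sym; trans to ≈-trans)
  open RingDefs R
  open RingProperties ring using (-‿distribˡ-*; -‿distribʳ-*; -‿involutive; -0#≈0#; -‿+-comm; +-identityʳ-unique)
  open SemiringSum semiring using ()
    renaming (sum to ∑ᴿ; sum-cong-≋ to ∑ᴿ-cong; ∑-distrib-+ to ∑ᴿ-distrib-+; *-distribˡ-sum to *-distribˡ-∑ᴿ)
  open CommutativeSemiringSolver commutativeSemiring using (solve; _:+_; _:*_; _:=_; con)
  open SetoidReasoning setoid

  fromℕR-+ : ∀ m n → fromℕR (m +ℕ n) ≈ fromℕR m + fromℕR n
  fromℕR-+ zero    n = ≈-sym (+-identityˡ (fromℕR n))
  fromℕR-+ (suc m) n = ≈-trans (+-congˡ (fromℕR-+ m n)) (≈-sym (+-assoc 1# (fromℕR m) (fromℕR n)))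

  fromℕR-* : ∀ m n → fromℕR (m *ℕ n) ≈ fromℕR m * fromℕR n
  fromℕR-* zero    n = ≈-sym (zeroˡ (fromℕR n))
  fromℕR-* (suc m) n = begin
    fromℕR (n +ℕ m *ℕ n)                  ≈⟨ fromℕR-+ n (m *ℕ n) ⟩
    fromℕR n + fromℕR (m *ℕ n)            ≈⟨ +-congˡ (fromℕR-* m n) ⟩
    fromℕR n + fromℕR m * fromℕR n        ≈⟨ +-congʳ (*-identityˡ (fromℕR n)) ⟨
    1# * fromℕR n + fromℕR m * fromℕR n   ≈⟨ distribʳ (fromℕR n) 1# (fromℕR m) ⟨
    (1# + fromℕR m) * fromℕR n            ∎

  fromℕR-1 : fromℕR 1 ≈ 1#
  fromℕR-1 = +-identityʳ 1#

  fromℕR-+-cancelˡ : ∀ m n → fromℕR (m +ℕ n) + - fromℕR m ≈ fromℕR n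
  fromℕR-+-cancelˡ m n = begin
    fromℕR (m +ℕ n) + - fromℕR m          ≈⟨ +-congʳ (≈-trans (fromℕR-+ m n) (+-comm (fromℕR m) (fromℕR n))) ⟩
    (fromℕR n + fromℕR m) + - fromℕR m    ≈⟨ +-assoc (fromℕR n) (fromℕR m) (- fromℕR m) ⟩
    fromℕR n + (fromℕR m + - fromℕR m)    ≈⟨ +-congˡ (-‿inverseʳ (fromℕR m)) ⟩
    fromℕR n + 0#                         ≈⟨ +-identityʳ (fromℕR n) ⟩
    fromℕR n                              ∎

  fromℕR-sum : ∀ {n} (f : Fin n → ℕ) → fromℕR (sum f) ≈ ∑ᴿ (fromℕR ∘ f)
  fromℕR-sum {zero}  f = ≈-refl
  fromℕR-sum {suc n} f = ≈-trans (fromℕR-+ (f fz) (sum (f ∘ fs))) (+-congˡ (fromℕR-sum (f ∘ fs)))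

  fromℕR-𝟙-∧ : ∀ b₁ b₂ → fromℕR (𝟙 (b₁ ∧ b₂)) ≈ fromℕR (𝟙 b₁) * fromℕR (𝟙 b₂)
  fromℕR-𝟙-∧ b₁ b₂ = ≈-trans (reflexive (cong fromℕR (𝟙-∧ b₁ b₂))) (fromℕR-* (𝟙 b₁) (𝟙 b₂))
    where
    𝟙-∧ : ∀ b₁ b₂ → 𝟙 (b₁ ∧ b₂) ≡ 𝟙 b₁ *ℕ 𝟙 b₂
    𝟙-∧ true  b₂ = sym (ℕ.+-identityʳ (𝟙 b₂))
    𝟙-∧ false b₂ = refl

  sumR≡∑ᴿ : ∀ {n} (f : Fin n → Carrier) → sumR f ≡ ∑ᴿ f
  sumR≡∑ᴿ {zero}  f = refl
  sumR≡∑ᴿ {suc n} f = cong (f fz +_) (sumR≡∑ᴿ (f ∘ fs))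

  -- As a polynomial identity in -p it needs no subtraction, so the semiring solver applies.
  expand-product : ∀ p x y u → ((1# + - (p * x)) * u) * ((1# + - (p * y)) * u) ≈
                               (u * u) * ((1# + (p * p) * (x * y)) + - (p * x + p * y))
  expand-product p x y u = begin
    ((1# + - (p * x)) * u) * ((1# + - (p * y)) * u)
      ≈⟨ *-cong (*-congʳ (+-congˡ (-‿distribˡ-* p x))) (*-congʳ (+-congˡ (-‿distribˡ-* p y))) ⟩
    ((1# + (- p) * x) * u) * ((1# + (- p) * y) * u)
      ≈⟨ solve 4 (λ n x y u → ((con 1 :+ n :* x) :* u) :* ((con 1 :+ n :* y) :* u) :=
                              (u :* u) :* ((con 1 :+ (n :* n) :* (x :* y)) :+ (n :* x :+ n :* y))) ≈-refl (- p) x y u ⟩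
    (u * u) * ((1# + ((- p) * (- p)) * (x * y)) + ((- p) * x + (- p) * y))
      ≈⟨ *-congˡ (+-cong (+-congˡ (*-congʳ neg*neg)) negated-sum) ⟩
    (u * u) * ((1# + (p * p) * (x * y)) + - (p * x + p * y)) ∎
    where
    neg*neg : (- p) * (- p) ≈ p * p
    neg*neg = ≈-trans (≈-sym (-‿distribˡ-* p (- p))) (≈-trans (-‿cong (≈-sym (-‿distribʳ-* p p))) (-‿involutive (p * p)))
    negated-sum : (- p) * x + (- p) * y ≈ - (p * x + p * y)
    negated-sum = ≈-trans (+-cong (≈-sym (-‿distribˡ-* p x)) (≈-sym (-‿distribˡ-* p y))) (-‿+-comm (p * x) (p * y))

  module Entries (r : ℕ) (u : Carrier) where

    entry : Bool → Carrier
    entry b = if b then (1# + - fromℕR r) * u else u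

    entry≈ : ∀ b → entry b ≈ (1# + - (fromℕR r * fromℕR (𝟙 b))) * u
    entry≈ true  = *-congʳ (+-congˡ (-‿cong (≈-sym (≈-trans (*-congˡ fromℕR-1) (*-identityʳ (fromℕR r))))))
    entry≈ false = begin
      u                                   ≈⟨ *-identityˡ u ⟨
      1# * u                              ≈⟨ *-congʳ (+-identityʳ 1#) ⟨
      (1# + 0#) * u                       ≈⟨ *-congʳ (+-congˡ -0#≈0#) ⟨
      (1# + - 0#) * u                     ≈⟨ *-congʳ (+-congˡ (-‿cong (zeroʳ (fromℕR r)))) ⟨
      (1# + - (fromℕR r * 0#)) * u        ∎

    entry-product : ∀ b₁ b₂ → entry b₁ * entry b₂ ≈
      (u * u) * (fromℕR (1 +ℕ r *ℕ r *ℕ 𝟙 (b₁ ∧ b₂)) + - fromℕR (r *ℕ 𝟙 b₁ +ℕ r *ℕ 𝟙 b₂))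
    entry-product b₁ b₂ = begin
      entry b₁ * entry b₂
        ≈⟨ *-cong (entry≈ b₁) (entry≈ b₂) ⟩
      ((1# + - (ρ * β₁)) * u) * ((1# + - (ρ * β₂)) * u)
        ≈⟨ expand-product ρ β₁ β₂ u ⟩
      (u * u) * ((1# + (ρ * ρ) * (β₁ * β₂)) + - (ρ * β₁ + ρ * β₂))
        ≈⟨ *-congˡ (+-cong (≈-sym both) (-‿cong (≈-sym each))) ⟩
      (u * u) * (fromℕR (1 +ℕ r *ℕ r *ℕ 𝟙 (b₁ ∧ b₂)) + - fromℕR (r *ℕ 𝟙 b₁ +ℕ r *ℕ 𝟙 b₂)) ∎
      where
      ρ β₁ β₂ : Carrier
      ρ  = fromℕR r
      β₁ = fromℕR (𝟙 b₁)
      β₂ = fromℕR (𝟙 b₂)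
      both : fromℕR (1 +ℕ r *ℕ r *ℕ 𝟙 (b₁ ∧ b₂)) ≈ 1# + (ρ * ρ) * (β₁ * β₂)
      both = ≈-trans (fromℕR-+ 1 (r *ℕ r *ℕ 𝟙 (b₁ ∧ b₂)))
               (+-cong fromℕR-1 (≈-trans (fromℕR-* (r *ℕ r) (𝟙 (b₁ ∧ b₂))) (*-cong (fromℕR-* r r) (fromℕR-𝟙-∧ b₁ b₂))))
      each : fromℕR (r *ℕ 𝟙 b₁ +ℕ r *ℕ 𝟙 b₂) ≈ ρ * β₁ + ρ * β₂
      each = ≈-trans (fromℕR-+ (r *ℕ 𝟙 b₁) (r *ℕ 𝟙 b₂)) (+-cong (fromℕR-* r (𝟙 b₁)) (fromℕR-* r (𝟙 b₂)))

    row-product : ∀ {N} (p q : Fin N → Bool) → sumR (λ j → entry (p j) * entry (q j)) ≈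
      (u * u) * (fromℕR (∑[ j < N ] (1 +ℕ r *ℕ r *ℕ 𝟙 (p j ∧ q j))) + - fromℕR (∑[ j < N ] (r *ℕ 𝟙 (p j) +ℕ r *ℕ 𝟙 (q j))))
    row-product {N} p q = begin
      sumR (λ j → entry (p j) * entry (q j))
        ≡⟨ sumR≡∑ᴿ (λ j → entry (p j) * entry (q j)) ⟩
      ∑ᴿ (λ j → entry (p j) * entry (q j))
        ≈⟨ ∑ᴿ-cong (λ j → entry-product (p j) (q j)) ⟩
      ∑ᴿ (λ j → (u * u) * (X j + - Y j))
        ≈⟨ *-distribˡ-∑ᴿ (u * u) (λ j → X j + - Y j) ⟨
      (u * u) * ∑ᴿ (λ j → X j + - Y j)
        ≈⟨ *-congˡ (∑ᴿ-distrib-+ X (λ j → - Y j)) ⟩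
      (u * u) * (∑ᴿ X + ∑ᴿ (λ j → - Y j))
        ≈⟨ *-congˡ (+-congˡ (sum-neg ring Y)) ⟩
      (u * u) * (∑ᴿ X + - ∑ᴿ Y)
        ≈⟨ *-congˡ (+-cong (fromℕR-sum x) (-‿cong (fromℕR-sum y))) ⟨
      (u * u) * (fromℕR (sum x) + - fromℕR (sum y)) ∎
      where
      x y : Fin N → ℕ
      x j = 1 +ℕ r *ℕ r *ℕ 𝟙 (p j ∧ q j)
      y j = r *ℕ 𝟙 (p j) +ℕ r *ℕ 𝟙 (q j)
      X Y : Fin N → Carrier
      X = fromℕR ∘ x
      Y = fromℕR ∘ y

    u≈[1-r]u⇒r≡0 : (∀ n → fromℕR n ≈ 0# → n ≡ 0) → ∀ {s} → s * u ≈ 1# → u ≈ (1# + - fromℕR r) * u → r ≡ 0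
    u≈[1-r]u⇒r≡0 char-zero {s} su≈1 u≈[1-r]u = char-zero r (begin
      fromℕR r                   ≈⟨ *-identityʳ (fromℕR r) ⟨
      fromℕR r * 1#              ≈⟨ *-congˡ su≈1 ⟨
      fromℕR r * (s * u)         ≈⟨ solve 3 (λ ρ s u → ρ :* (s :* u) := s :* (ρ :* u)) ≈-refl (fromℕR r) s u ⟩
      s * (fromℕR r * u)         ≈⟨ *-congˡ ru≈0 ⟩
      s * 0#                     ≈⟨ zeroʳ s ⟩
      0#                         ∎)
      where
      -ru≈0 : - (fromℕR r * u) ≈ 0#
      -ru≈0 = +-identityʳ-unique u (- (fromℕR r * u)) (≈-sym (begin
        u                                  ≈⟨ u≈[1-r]u ⟩
        (1# + - fromℕR r) * u              ≈⟨ distribʳ u 1# (- fromℕR r) ⟩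
        1# * u + (- fromℕR r) * u          ≈⟨ +-cong (≈-sym (*-identityˡ u)) (-‿distribˡ-* (fromℕR r) u) ⟨
        u + - (fromℕR r * u)               ∎))
      ru≈0 : fromℕR r * u ≈ 0#
      ru≈0 = ≈-trans (≈-sym (-‿involutive (fromℕR r * u))) (≈-trans (-‿cong -ru≈0) -0#≈0#)

module HyperplaneMatrix {c ℓ} (R : CommutativeRing c ℓ) (k t₂ : ℕ) (r-prime : Prime (suc (suc k)))
  {V : Fin (gauss (suc (suc k)) (suc (suc t₂))) → PSet (suc (suc k)) (suc (suc t₂))} (V-enum : IsHyperplaneEnum V)
  {P : Fin (suc (suc k) ^ suc (suc t₂)) → Point (suc (suc k)) (suc (suc t₂))} (P-enum : IsPointEnum P)
  (sinv : CommutativeRing.Carrier R) where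

  private
    r t G : ℕ
    r = suc (suc k)
    t = suc (suc t₂)
    G = gauss r t

  open Hyperplanes r r-prime V V-enum
  open CommutativeRing R using (Carrier; _≈_; _+_; _*_; -_; 0#; 1#; *-cong; *-congˡ; zeroʳ; *-identityʳ; -‿inverseʳ)
    renaming (refl to ≈-refl; trans to ≈-trans; reflexive to ≈-reflexive)
  open RingDefs R
  open MatrixEntries R
  open Entries r sinv

  gauss-count : G *ℕ (r ∸ 1) ≡ r ^ t ∸ 1
  gauss-count = GeometricSum.gauss-*-pred k t

  common : Fin G → Fin G → ℕ
  common i i′ = ∑ᵥ (λ x → 𝟙 (V i x ∧ V i′ x))

  incidences : ℕ
  incidences = r *ℕ r ^ suc t₂ +ℕ r *ℕ r ^ suc t₂

  row-sums : ∀ i i′ → sumR (λ j → Hmat r t sinv V P i j * Hmat r t sinv V P i′ j) ≈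
                      (sinv * sinv) * (fromℕR (r ^ t +ℕ r *ℕ r *ℕ common i i′) + - fromℕR incidences)
  row-sums i i′ = ≈-trans (row-product (λ j → V i (P j)) (λ j → V i′ (P j)))
    (*-congˡ (≈-reflexive (cong₂ (λ m n → fromℕR m + - fromℕR n) both-count each-count)))
    where
    open ≡-Reasoning
    both-count : ∑[ j < r ^ t ] (1 +ℕ r *ℕ r *ℕ 𝟙 (V i (P j) ∧ V i′ (P j))) ≡ r ^ t +ℕ r *ℕ r *ℕ common i i′
    both-count = begin
      ∑[ j < r ^ t ] (1 +ℕ r *ℕ r *ℕ 𝟙 (V i (P j) ∧ V i′ (P j)))
        ≡⟨ ∑-pointEnum P-enum (λ x → 1 +ℕ r *ℕ r *ℕ 𝟙 (V i x ∧ V i′ x)) ⟩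
      ∑ᵥ (λ x → 1 +ℕ r *ℕ r *ℕ 𝟙 (V i x ∧ V i′ x))
        ≡⟨ ∑ᵥ-+ (λ _ → 1) (λ x → r *ℕ r *ℕ 𝟙 (V i x ∧ V i′ x)) ⟩
      ∑ᵥ {t} (λ _ → 1) +ℕ ∑ᵥ (λ x → r *ℕ r *ℕ 𝟙 (V i x ∧ V i′ x))
        ≡⟨ cong₂ _+ℕ_ (trans (sum-const (r ^ t) 1) (ℕ.*-identityʳ (r ^ t)))
                      (∑ᵥ-*ˡ (r *ℕ r) (λ x → 𝟙 (V i x ∧ V i′ x))) ⟩
      r ^ t +ℕ r *ℕ r *ℕ common i i′ ∎
    each-count : ∑[ j < r ^ t ] (r *ℕ 𝟙 (V i (P j)) +ℕ r *ℕ 𝟙 (V i′ (P j))) ≡ incidences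
    each-count = begin
      ∑[ j < r ^ t ] (r *ℕ 𝟙 (V i (P j)) +ℕ r *ℕ 𝟙 (V i′ (P j)))
        ≡⟨ ∑-pointEnum P-enum (λ x → r *ℕ 𝟙 (V i x) +ℕ r *ℕ 𝟙 (V i′ x)) ⟩
      ∑ᵥ (λ x → r *ℕ 𝟙 (V i x) +ℕ r *ℕ 𝟙 (V i′ x))
        ≡⟨ ∑ᵥ-+ (λ x → r *ℕ 𝟙 (V i x)) (λ x → r *ℕ 𝟙 (V i′ x)) ⟩
      ∑ᵥ (λ x → r *ℕ 𝟙 (V i x)) +ℕ ∑ᵥ (λ x → r *ℕ 𝟙 (V i′ x))
        ≡⟨ cong₂ _+ℕ_ (trans (∑ᵥ-*ˡ r (𝟙 ∘ V i)) (cong (r *ℕ_) (count-V i)))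
                      (trans (∑ᵥ-*ˡ r (𝟙 ∘ V i′)) (cong (r *ℕ_) (count-V i′))) ⟩
      incidences ∎

  diagonal-count : ∀ i → r ^ t +ℕ r *ℕ r *ℕ common i i ≡ incidences +ℕ r ^ t *ℕ (r ∸ 1)
  diagonal-count i = trans (cong (λ m → r ^ t +ℕ r *ℕ r *ℕ m) (trans (∑ᵥ-cong (cong 𝟙 ∘ ∧-idem ∘ V i)) (count-V i)))
                           (expand k (r ^ t₂))
    where
    open +-*-Solver
    expand : ∀ k p → let r = 2 +ℕ k in
             r *ℕ (r *ℕ p) +ℕ r *ℕ r *ℕ (r *ℕ p) ≡ (r *ℕ (r *ℕ p) +ℕ r *ℕ (r *ℕ p)) +ℕ r *ℕ (r *ℕ p) *ℕ (1 +ℕ k)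
    expand = solve 2 (λ k p → let r = con 2 :+ k in
               r :* (r :* p) :+ r :* r :* (r :* p) := (r :* (r :* p) :+ r :* (r :* p)) :+ r :* (r :* p) :* (con 1 :+ k)) refl

  off-diagonal-count : ∀ {i i′} → i ≢ i′ → r ^ t +ℕ r *ℕ r *ℕ common i i′ ≡ incidences
  off-diagonal-count i≢i′ =
    trans (cong (λ m → r ^ t +ℕ r *ℕ r *ℕ m) (count-V∩V i≢i′)) (cong (r ^ t +ℕ_) (ℕ.*-assoc r r (r ^ t₂)))

  orthonormal-rows : ∀ {s} → s * s ≈ fromℕR (r ^ t *ℕ (r ∸ 1)) → s * sinv ≈ 1# →
                     ∀ i i′ → sumR (λ j → Hmat r t sinv V P i j * Hmat r t sinv V P i′ j) ≈ δ i i′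
  orthonormal-rows {s} s² ssinv i i′ = by-cases (i Fin.≟ i′)
    where
    open SetoidReasoning (CommutativeRing.setoid R)
    open CommutativeSemiringSolver (CommutativeRing.commutativeSemiring R) using (solve; _:*_; _:=_)
    by-cases : (d : Dec (i ≡ i′)) → sumR (λ j → Hmat r t sinv V P i j * Hmat r t sinv V P i′ j) ≈ (if does d then 1# else 0#)
    by-cases (yes refl) = begin
      sumR (λ j → Hmat r t sinv V P i j * Hmat r t sinv V P i j)
        ≈⟨ row-sums i i ⟩
      (sinv * sinv) * (fromℕR (r ^ t +ℕ r *ℕ r *ℕ common i i) + - fromℕR incidences)
        ≡⟨ cong (λ m → (sinv * sinv) * (fromℕR m + - fromℕR incidences)) (diagonal-count i) ⟩
      (sinv * sinv) * (fromℕR (incidences +ℕ r ^ t *ℕ (r ∸ 1)) + - fromℕR incidences)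
        ≈⟨ *-congˡ (fromℕR-+-cancelˡ incidences (r ^ t *ℕ (r ∸ 1))) ⟩
      (sinv * sinv) * fromℕR (r ^ t *ℕ (r ∸ 1))
        ≈⟨ *-congˡ s² ⟨
      (sinv * sinv) * (s * s)
        ≈⟨ solve 2 (λ u s → (u :* u) :* (s :* s) := (s :* u) :* (s :* u)) ≈-refl sinv s ⟩
      (s * sinv) * (s * sinv)
        ≈⟨ *-cong ssinv ssinv ⟩
      1# * 1#
        ≈⟨ *-identityʳ 1# ⟩
      1# ∎
    by-cases (no i≢i′) = begin
      sumR (λ j → Hmat r t sinv V P i j * Hmat r t sinv V P i′ j)
        ≈⟨ row-sums i i′ ⟩
      (sinv * sinv) * (fromℕR (r ^ t +ℕ r *ℕ r *ℕ common i i′) + - fromℕR incidences)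
        ≡⟨ cong (λ m → (sinv * sinv) * (fromℕR m + - fromℕR incidences)) (off-diagonal-count i≢i′) ⟩
      (sinv * sinv) * (fromℕR incidences + - fromℕR incidences)
        ≈⟨ *-congˡ (-‿inverseʳ (fromℕR incidences)) ⟩
      (sinv * sinv) * 0#
        ≈⟨ zeroʳ (sinv * sinv) ⟩
      0# ∎

  column-count : (∀ n → fromℕR n ≈ 0# → n ≡ 0) → ∀ {s} → s * sinv ≈ 1# → ∀ j → P j ≢ 0P →
    ∃ λ (xs : List (Fin G)) →
        Unique xs × length xs ≡ gauss r (t ∸ 1)
      × (∀ i → (i ∈ xs → Hmat r t sinv V P i j ≈ (1# + (- fromℕR r)) * sinv)
             × (Hmat r t sinv V P i j ≈ (1# + (- fromℕR r)) * sinv → i ∈ xs))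
  column-count char-zero ssinv j Pj≢0 = xs , filter⁺ (T? ∘ through) (allFin⁺ G) , xs-length , membership
    where
    through : Fin G → Bool
    through i = V i (P j)
    xs : List (Fin G)
    xs = filter (T? ∘ through) (allFin G)
    xs-length : length xs ≡ gauss r (suc t₂)
    xs-length = trans (length-filter-tabulate through (λ i → i))
      (ℕ.*-cancelʳ-≡ _ (gauss r (suc t₂)) (suc k)
        (trans (count-V-through gauss-count Pj≢0) (sym (GeometricSum.gauss-*-pred k (suc t₂)))))
    T⇒entry≈ : ∀ b → T b → entry b ≈ (1# + (- fromℕR r)) * sinv
    T⇒entry≈ true _ = ≈-refl
    entry≈⇒T : ∀ b → entry b ≈ (1# + (- fromℕR r)) * sinv → T b
    entry≈⇒T true  _        = _
    entry≈⇒T false u≈[1-r]u = case u≈[1-r]u⇒r≡0 char-zero ssinv u≈[1-r]u of λ ()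
    membership : ∀ i → (i ∈ xs → entry (through i) ≈ (1# + (- fromℕR r)) * sinv)
                     × (entry (through i) ≈ (1# + (- fromℕR r)) * sinv → i ∈ xs)
    membership i = (λ i∈xs → T⇒entry≈ (through i) (proj₂ (∈-filter⁻ (T? ∘ through) {xs = allFin G} i∈xs)))
                 , (λ e → ∈-filter⁺ (T? ∘ through) (∈-allFin i) (entry≈⇒T (through i) e))

lemma4p9 : {c ℓ' : Level} (R : CommutativeRing c ℓ') →
  let open CommutativeRing R
      open RingDefs R
  in
  (∀ n → fromℕR n ≈ 0# → n ≡ 0) →
  (r t : ℕ) .{{_ : NonZero r}} → 2 ≤ t → Prime r →
  -- s = √(r^t (r-1)) and sinv = 1/s
  (s sinv : Carrier) → s * s ≈ fromℕR (r ^ t *ℕ (r ∸ 1)) → s * sinv ≈ 1# →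
  (V : Fin (gauss r t) → PSet r t) → IsHyperplaneEnum V →
  (P : Fin (r ^ t) → Point r t) → IsPointEnum P →
  (∀ i k → sumR (λ j → Hmat r t sinv V P i j * Hmat r t sinv V P k j) ≈ δ i k)
  ×
  (∀ j → P j ≢ 0P →
    ∃ λ (xs : List (Fin (gauss r t))) →
        Unique xs × length xs ≡ gauss r (t ∸ 1)
      × (∀ i → (i ∈ xs → Hmat r t sinv V P i j ≈ (1# + (- fromℕR r)) * sinv)
             × (Hmat r t sinv V P i j ≈ (1# + (- fromℕR r)) * sinv → i ∈ xs)))
lemma4p9 R char-zero zero          t _ r-prime = ⊥-elim (¬prime[0] r-prime)
lemma4p9 R char-zero (suc zero)    t _ r-prime = ⊥-elim (¬prime[1] r-prime)
lemma4p9 R char-zero (suc (suc k)) (suc (suc t₂)) (s≤s (s≤s z≤n)) r-prime s sinv s² ssinv V V-enum P P-enum =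
  orthonormal-rows s² ssinv , column-count char-zero ssinv
  where open HyperplaneMatrix R k t₂ r-prime V-enum P-enum sinv
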